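{- Let $t \ge 0$ be an integer and let $p(t)$ denote the number of partitions of $t$. For integers $n \ge 2$, let $e(P_n,t)$ denote the number of left-justified arrays of non-negative integers with $n$ rows, of lengths $2,3,\ldots,n-1,n,n$ respectively (so the first row has length $2$ and the last two rows both have length $n$), in which every row sum and every column sum equals $t$; and set $e(P_1,t)=1$. Then the sequence $\bigl(e(P_n,t)\bigr)_{n\ge 1}$ satisfies a linear recursion of degree $p(t)$ with integer coefficients; that is, there exist integers $c_1,\ldots,c_{p(t)}$ such that $$e(P_n,t)=\sum_{i=1}^{p(t)} c_i\, e(P_{n-i},t)\quad\text{for all } n> p(t).$$
   Context: For $n\ge 2$, $P_n$ is the convex hull of the set of $n\times n$ permutation matrices $\pi$ with $\pi_{ij}=0$ whenever $j\ge i+2$, and $e(P_n,t)$ is its Ehrhart polynomial evaluated at $t$, which equals the number of arrays described in the claim (the array lists the entries $\pi_{ij}$ with $j\le i+1$ of an integer matrix in $t\cdot P_n$). -}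

module Defs where

open import Data.Nat using (ℕ; zero; suc; _+_; _≤_; _≥_)
open import Data.Nat.Properties using (_≟_; _≤?_; _≥?_)
open import Data.Integer as ℤ using (ℤ)
open import Data.Fin using (Fin; toℕ) renaming (zero to fzero; suc to fsuc)
open import Data.List using (List; []; _∷_; [_]; _++_; map; concatMap; length; filter; upTo)
open import Data.Nat.ListAction using (sum)
open import Data.List.Relation.Unary.All using (All; all?)
open import Data.List.Relation.Unary.Linked using (Linked; linked?)
open import Data.Product using (_×_)
open import Relation.Binary.PropositionalEquality using (_≡_)
open import Relation.Nullary using (Dec)
open import Relation.Nullary.Decidable using (_×-dec_)

listsOver : ℕ → List ℕ → List (List ℕ)
listsOver zero    vs = [ [] ]
listsOver (suc k) vs = concatMap (λ x → map (x ∷_) (listsOver k vs)) vs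

IsPartition : ℕ → List ℕ → Set
IsPartition t l = (sum l ≡ t) × (Linked _≥_ l × All (λ x → 1 ≤ x) l)

isPartition? : (t : ℕ) (l : List ℕ) → Dec (IsPartition t l)
isPartition? t l = (sum l ≟ t) ×-dec (linked? _≥?_ l ×-dec all? (1 ≤?_) l)

-- every partition of t has at most t parts, each in {1,…,t}
partitionCandidates : ℕ → List (List ℕ)
partitionCandidates t = concatMap (λ k → listsOver k (map suc (upTo t))) (upTo (suc t))

partitionCount : ℕ → ℕ
partitionCount t = length (filter (isPartition? t) (partitionCandidates t))

-- row lengths for n ≥ 2 : 2,3,…,n (that is, (i+2) for i < n-1) followed by n
rowLengths : ℕ → List ℕ
rowLengths zero    = []
rowLengths (suc m) = map (λ i → i + 2) (upTo m) ++ [ suc m ]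

arraysOfShape : List ℕ → List ℕ → List (List (List ℕ))
arraysOfShape []       vs = [ [] ]
arraysOfShape (k ∷ ks) vs =
  concatMap (λ r → map (r ∷_) (arraysOfShape ks vs)) (listsOver k vs)

entryAt : ℕ → List ℕ → List ℕ
entryAt _       []       = []
entryAt zero    (x ∷ _)  = [ x ]
entryAt (suc j) (_ ∷ xs) = entryAt j xs

column : ℕ → List (List ℕ) → List ℕ
column j A = concatMap (entryAt j) A

IsMagic : ℕ → ℕ → List (List ℕ) → Set
IsMagic n t A = All (λ r → sum r ≡ t) A × All (λ j → sum (column j A) ≡ t) (upTo n)

isMagic? : (n t : ℕ) (A : List (List ℕ)) → Dec (IsMagic n t A)
isMagic? n t A = all? (λ r → sum r ≟ t) A ×-dec all? (λ j → sum (column j A) ≟ t) (upTo n)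

-- e(P_n, t): for n ≥ 2 the number of such arrays (entries are ≤ t since row
-- sums are t); e(P_1,t) = 1; e(P_0,t) = 0 is a dummy value never used.
eP : ℕ → ℕ → ℕ
eP zero          t = 0
eP (suc zero)    t = 1
eP (suc (suc m)) t =
  length (filter (isMagic? (suc (suc m)) t)
                 (arraysOfShape (rowLengths (suc (suc m))) (upTo (suc t))))

∑ : ∀ {k} → (Fin k → ℤ) → ℤ
∑ {zero}  f = ℤ.+ 0
∑ {suc k} f = f fzero ℤ.+ ∑ (λ i → f (fsuc i))

-- Fill the array row by row. After some rows, the columns opened so far still lack amounts
-- (deficits) summing to t, and the number of ways to finish depends on these deficits only up to
-- order and zero entries, i.e. only on the partition of t they form. Hence the completion counts
-- form a vector v(k) indexed by the p(t) partitions of t with v(k+1) = M v(k) for a nonnegative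
-- integer matrix M, and e(P_{k+1}, t) is a coordinate of v(k). By Cayley–Hamilton, proved over the
-- ring of shift operators by Cramer's rule, each coordinate is annihilated by the characteristic
-- polynomial of M, which is monic of degree p(t) with integer coefficients.

module Submission where

open import Algebra.Bundles using (CommutativeRing)
open import Data.Nat using (ℕ)

module NatRangeSum where

  open import Data.Nat using (ℕ; zero; suc; _+_; _*_; _<_; z≤n; s≤s)
  import Data.Nat.Properties as ℕP
  open import Data.Bool using (Bool; true; false; T; _∧_)
  open import Data.Unit using (tt)
  open import Relation.Binary.PropositionalEquality
  open import Data.Nat.Tactic.RingSolver

  bit : Bool → ℕ
  bit true = 1
  bit false = 0

  bit-*-cong : ∀ b m n → (T b → m ≡ n) → bit b * m ≡ bit b * n
  bit-*-cong true m n f = cong (λ x → x + 0) (f tt)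
  bit-*-cong false m n f = refl

  sumℕ : ℕ → (ℕ → ℕ) → ℕ
  sumℕ zero f = 0
  sumℕ (suc n) f = f 0 + sumℕ n (λ j → f (suc j))

  sumℕ-cong : ∀ n {f g} → (∀ j → j < n → f j ≡ g j) → sumℕ n f ≡ sumℕ n g
  sumℕ-cong zero e = refl
  sumℕ-cong (suc n) e = cong₂ _+_ (e 0 (s≤s z≤n)) (sumℕ-cong n (λ j lt → e (suc j) (s≤s lt)))

  sumℕ-0 : ∀ n f → (∀ j → j < n → f j ≡ 0) → sumℕ n f ≡ 0
  sumℕ-0 zero f e = refl
  sumℕ-0 (suc n) f e rewrite e 0 (s≤s z≤n) = sumℕ-0 n (λ j → f (suc j)) (λ j lt → e (suc j) (s≤s lt))

  sumℕ-+ : ∀ n f g → sumℕ n (λ j → f j + g j) ≡ sumℕ n f + sumℕ n g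
  sumℕ-+ zero f g = refl
  sumℕ-+ (suc n) f g rewrite sumℕ-+ n (λ j → f (suc j)) (λ j → g (suc j)) =
    rearrange (f 0) (g 0) (sumℕ n (λ j → f (suc j))) (sumℕ n (λ j → g (suc j)))
    where
    rearrange : ∀ a b A B → (a + b) + (A + B) ≡ (a + A) + (b + B)
    rearrange = solve-∀

  sumℕ-*r : ∀ n f c → sumℕ n (λ j → f j * c) ≡ sumℕ n f * c
  sumℕ-*r zero f c = refl
  sumℕ-*r (suc n) f c rewrite sumℕ-*r n (λ j → f (suc j)) c = sym (ℕP.*-distribʳ-+ c (f 0) _)

  sumℕ-*l : ∀ n c f → sumℕ n (λ j → c * f j) ≡ c * sumℕ n f
  sumℕ-*l zero c f = sym (ℕP.*-zeroʳ c)
  sumℕ-*l (suc n) c f rewrite sumℕ-*l n c (λ j → f (suc j)) = sym (ℕP.*-distribˡ-+ c (f 0) _)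

  sumℕ-swap : ∀ n m (g : ℕ → ℕ → ℕ) → sumℕ n (λ i → sumℕ m (λ j → g i j)) ≡ sumℕ m (λ j → sumℕ n (λ i → g i j))
  sumℕ-swap zero m g = sym (sumℕ-0 m (λ _ → 0) (λ _ _ → refl))
  sumℕ-swap (suc n) m g rewrite sumℕ-swap n m (λ i j → g (suc i) j) =
    sym (sumℕ-+ m (λ j → g 0 j) (λ j → sumℕ n (λ i → g (suc i) j)))

  sumℕ-*-interchange : ∀ n m (a b : ℕ → ℕ) (F : ℕ → ℕ → ℕ) →
    sumℕ n (λ x → a x * sumℕ m (λ y → b y * F x y)) ≡ sumℕ m (λ y → b y * sumℕ n (λ x → a x * F x y))
  sumℕ-*-interchange n m a b F =
    trans (sumℕ-cong n (λ x _ → trans (sym (sumℕ-*l m (a x) (λ y → b y * F x y)))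
             (sumℕ-cong m (λ y _ → *-leftCommute (a x) (b y) (F x y)))))
     (trans (sumℕ-swap n m (λ x y → b y * (a x * F x y)))
       (sumℕ-cong m (λ y _ → sumℕ-*l n (b y) (λ x → a x * F x y))))
    where
    *-leftCommute : ∀ a b f → a * (b * f) ≡ b * (a * f)
    *-leftCommute = solve-∀

  bit-∧ : ∀ a b → bit (a ∧ b) ≡ bit a * bit b
  bit-∧ true true = refl
  bit-∧ true false = refl
  bit-∧ false b = refl

  bit-∧0 : ∀ a b → bit a * (bit b + 0) ≡ bit (a ∧ b)
  bit-∧0 true true = refl
  bit-∧0 true false = refl
  bit-∧0 false b = refl

module IntegerRangeSum where

  open NatRangeSum using (sumℕ)
  open import Defs using (∑)
  open import Data.Integer using (ℤ; +_; _+_; -_; 0ℤ)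
  import Data.Integer.Properties as ℤP
  open import Data.Nat using (ℕ; zero; suc; _<_; _∸_; z≤n; s≤s)
  open import Data.Fin using (Fin; toℕ) renaming (zero to fzero; suc to fsuc)
  import Data.Nat.Properties as ℕP
  open import Relation.Binary.PropositionalEquality
  open import Data.Integer.Tactic.RingSolver

  sumℤ : ℕ → (ℕ → ℤ) → ℤ
  sumℤ zero f = 0ℤ
  sumℤ (suc n) f = f 0 + sumℤ n (λ j → f (suc j))

  sumℤ-cong : ∀ n {f g} → (∀ j → j < n → f j ≡ g j) → sumℤ n f ≡ sumℤ n g
  sumℤ-cong zero e = refl
  sumℤ-cong (suc n) e = cong₂ _+_ (e 0 (s≤s z≤n)) (sumℤ-cong n (λ j lt → e (suc j) (s≤s lt)))

  sumℤ-0 : ∀ n f → (∀ j → j < n → f j ≡ 0ℤ) → sumℤ n f ≡ 0ℤ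
  sumℤ-0 zero f e = refl
  sumℤ-0 (suc n) f e rewrite e 0 (s≤s z≤n) | sumℤ-0 n (λ j → f (suc j)) (λ j lt → e (suc j) (s≤s lt)) = refl

  sumℤ-+ : ∀ n f g → sumℤ n (λ j → f j + g j) ≡ sumℤ n f + sumℤ n g
  sumℤ-+ zero f g = refl
  sumℤ-+ (suc n) f g rewrite sumℤ-+ n (λ j → f (suc j)) (λ j → g (suc j)) =
    rearrange (f 0) (g 0) (sumℤ n (λ j → f (suc j))) (sumℤ n (λ j → g (suc j)))
    where
    rearrange : ∀ a b A B → (a + b) + (A + B) ≡ (a + A) + (b + B)
    rearrange = solve-∀

  sumℤ-neg : ∀ n f → sumℤ n (λ j → - f j) ≡ - sumℤ n f
  sumℤ-neg zero f = refl
  sumℤ-neg (suc n) f rewrite sumℤ-neg n (λ j → f (suc j)) = sym (ℤP.neg-distrib-+ (f 0) _)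

  sumℤ-single : ∀ n i g → i < n → (∀ j → j < n → j ≢ i → g j ≡ 0ℤ) → sumℤ n g ≡ g i
  sumℤ-single (suc n) zero g lt h =
    trans (cong (_+_ (g 0)) (sumℤ-0 n (λ j → g (suc j)) (λ j lt → h (suc j) (s≤s lt) (λ ())))) (ℤP.+-identityʳ _)
  sumℤ-single (suc n) (suc i) g (s≤s lt) h =
    trans (cong (_+ sumℤ n (λ j → g (suc j))) (h 0 (s≤s z≤n) (λ ())))
     (trans (ℤP.+-identityˡ _) (sumℤ-single n i (λ j → g (suc j)) lt
        (λ j jlt ne → h (suc j) (s≤s jlt) (λ e → ne (ℕP.suc-injective e)))))

  sumℤ-last : ∀ n f → sumℤ (suc n) f ≡ sumℤ n f + f n
  sumℤ-last zero f = trans (ℤP.+-identityʳ (f 0)) (sym (ℤP.+-identityˡ (f 0)))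
  sumℤ-last (suc n) f rewrite sumℤ-last n (λ j → f (suc j)) = sym (ℤP.+-assoc (f 0) _ _)

  +-sumℕ : ∀ n f → + sumℕ n f ≡ sumℤ n (λ j → + f j)
  +-sumℕ zero f = refl
  +-sumℕ (suc n) f = trans (ℤP.pos-+ (f 0) (sumℕ n (λ j → f (suc j)))) (cong (_+_ (+ f 0)) (+-sumℕ n (λ j → f (suc j))))

  ∑-cong : ∀ {q} {f g : Fin q → ℤ} → (∀ i → f i ≡ g i) → ∑ f ≡ ∑ g
  ∑-cong {zero} e = refl
  ∑-cong {suc q} e = cong₂ _+_ (e fzero) (∑-cong (λ i → e (fsuc i)))

  sumℤ-reverse : ∀ p (g : ℕ → ℤ) → sumℤ p g ≡ ∑ {p} (λ i → g (p ∸ suc (toℕ i)))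
  sumℤ-reverse zero g = refl
  sumℤ-reverse (suc p) g = trans (sumℤ-last p g) (trans (ℤP.+-comm (sumℤ p g) (g p)) (cong (_+_ (g p)) (sumℤ-reverse p g)))

module LinearRecurrence where

  open IntegerRangeSum
  open import Defs using (∑)
  open import Data.Nat using (ℕ; suc; _+_; _∸_; _<_; s≤s)
  import Data.Nat.Properties as ℕP
  open import Data.Integer using (ℤ; _*_)
  open import Data.Fin using (toℕ)
  import Data.Fin.Properties as FinP
  open import Relation.Binary.PropositionalEquality
  open ≡-Reasoning

  recurrence⇒reversed-∑ : ∀ p (a e u : ℕ → ℤ) → (∀ n → e (suc n) ≡ u n) →
    (∀ k → u (k + p) ≡ sumℤ p (λ m → a m * u (k + m))) →
    ∀ n → p < n → e n ≡ ∑ {p} (λ i → a (p ∸ suc (toℕ i)) * e (n ∸ suc (toℕ i)))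
  recurrence⇒reversed-∑ p a e u e≡u rec (suc n) (s≤s p≤n) = begin
    e (suc n)                                                      ≡⟨ e≡u n ⟩
    u n                                                            ≡⟨ cong u (sym (ℕP.m∸n+n≡m p≤n)) ⟩
    u (k + p)                                                      ≡⟨ rec k ⟩
    sumℤ p (λ m → a m * u (k + m))                                 ≡⟨ sumℤ-reverse p _ ⟩
    ∑ {p} (λ i → a (p ∸ suc (toℕ i)) * u (k + (p ∸ suc (toℕ i)))) ≡⟨ ∑-cong (λ i → cong (a (p ∸ suc (toℕ i)) *_) (earlier-term i)) ⟩
    ∑ {p} (λ i → a (p ∸ suc (toℕ i)) * e (suc n ∸ suc (toℕ i)))   ∎
    where
    k = n ∸ p
    index : ∀ x → x < p → n ∸ x ≡ suc (k + (p ∸ suc x))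
    index x x<p = begin
      n ∸ x                 ≡⟨ cong (_∸ x) (sym (ℕP.m∸n+n≡m p≤n)) ⟩
      (k + p) ∸ x           ≡⟨ ℕP.+-∸-assoc k (ℕP.<⇒≤ x<p) ⟩
      k + (p ∸ x)           ≡⟨ cong (k +_) (ℕP.+-∸-assoc 1 x<p) ⟩
      k + suc (p ∸ suc x)   ≡⟨ ℕP.+-suc k _ ⟩
      suc (k + (p ∸ suc x)) ∎
    earlier-term : ∀ i → u (k + (p ∸ suc (toℕ i))) ≡ e (suc n ∸ suc (toℕ i))
    earlier-term i = sym (trans (cong e (index (toℕ i) (FinP.toℕ<n i))) (e≡u _))

module ShiftOperator where

  open import Data.Integer using (ℤ; +_; _+_; _*_; -_; 0ℤ; 1ℤ)
  import Data.Integer.Properties as ℤP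
  open import Data.Nat using (ℕ; suc)
  open import Data.List using (List; []; _∷_; map)
  open import Relation.Binary.PropositionalEquality
  open import Data.Integer.Tactic.RingSolver
  open import Algebra.Bundles using (CommutativeRing)
  open import Algebra.Structures
  open import Level using (0ℓ)
  open import Data.Product using (_,_)

  -- a₀ ∷ a₁ ∷ … stands for the operator Σ aᵢ Sⁱ, where (S f) n = f (n + 1); two coefficient lists
  -- are identified when they act alike.
  Poly : Set
  Poly = List ℤ

  infixl 6 _⊕_
  infixl 7 _⊛_ _·_

  _⊕_ : Poly → Poly → Poly
  [] ⊕ q = q
  (a ∷ p) ⊕ [] = a ∷ p
  (a ∷ p) ⊕ (b ∷ q) = (a + b) ∷ (p ⊕ q)

  ⊖_ : Poly → Poly
  ⊖ p = map -_ p

  _·_ : ℤ → Poly → Poly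
  a · p = map (a *_) p

  _⊛_ : Poly → Poly → Poly
  [] ⊛ q = []
  (a ∷ p) ⊛ q = a · q ⊕ (0ℤ ∷ (p ⊛ q))

  Seq : Set
  Seq = ℕ → ℤ

  act : Poly → Seq → Seq
  act [] f n = 0ℤ
  act (a ∷ p) f n = a * f n + act p f (suc n)

  act-⊕ : ∀ p q f n → act (p ⊕ q) f n ≡ act p f n + act q f n
  act-⊕ [] q f n = sym (ℤP.+-identityˡ _)
  act-⊕ (a ∷ p) [] f n = sym (ℤP.+-identityʳ _)
  act-⊕ (a ∷ p) (b ∷ q) f n rewrite act-⊕ p q f (suc n) =
    rearrange a b (f n) (act p f (suc n)) (act q f (suc n))
    where
    rearrange : ∀ a b x P Q → (a + b) * x + (P + Q) ≡ (a * x + P) + (b * x + Q)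
    rearrange = solve-∀

  act-⊖ : ∀ p f n → act (⊖ p) f n ≡ - act p f n
  act-⊖ [] f n = refl
  act-⊖ (a ∷ p) f n rewrite act-⊖ p f (suc n) = rearrange a (f n) (act p f (suc n))
    where
    rearrange : ∀ a x P → (- a) * x + (- P) ≡ - (a * x + P)
    rearrange = solve-∀

  act-· : ∀ c p f n → act (c · p) f n ≡ c * act p f n
  act-· c [] f n = sym (ℤP.*-zeroʳ c)
  act-· c (a ∷ p) f n rewrite act-· c p f (suc n) = rearrange c a (f n) (act p f (suc n))
    where
    rearrange : ∀ c a x P → c * a * x + c * P ≡ c * (a * x + P)
    rearrange = solve-∀

  act-0∷ : ∀ p f n → act (0ℤ ∷ p) f n ≡ act p f (suc n)
  act-0∷ p f n = ℤP.+-identityˡ _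

  act-cong : ∀ p {f g} → (∀ m → f m ≡ g m) → ∀ n → act p f n ≡ act p g n
  act-cong [] e n = refl
  act-cong (a ∷ p) e n = cong₂ (λ x y → a * x + y) (e n) (act-cong p e (suc n))

  act-shift : ∀ p f n → act p f (suc n) ≡ act p (λ m → f (suc m)) n
  act-shift [] f n = refl
  act-shift (a ∷ p) f n = cong (_+_ (a * f (suc n))) (act-shift p f (suc n))

  act-pointwise-+ : ∀ p f g n → act p (λ m → f m + g m) n ≡ act p f n + act p g n
  act-pointwise-+ [] f g n = refl
  act-pointwise-+ (a ∷ p) f g n rewrite act-pointwise-+ p f g (suc n) =
    rearrange a (f n) (g n) (act p f (suc n)) (act p g (suc n))
    where
    rearrange : ∀ a x y P Q → a * (x + y) + (P + Q) ≡ (a * x + P) + (a * y + Q)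
    rearrange = solve-∀

  act-pointwise-* : ∀ p c f n → act p (λ m → c * f m) n ≡ c * act p f n
  act-pointwise-* [] c f n = sym (ℤP.*-zeroʳ c)
  act-pointwise-* (a ∷ p) c f n rewrite act-pointwise-* p c f (suc n) = rearrange a c (f n) (act p f (suc n))
    where
    rearrange : ∀ a c x P → a * (c * x) + c * P ≡ c * (a * x + P)
    rearrange = solve-∀

  act-zeroSeq : ∀ p n → act p (λ _ → 0ℤ) n ≡ 0ℤ
  act-zeroSeq [] n = refl
  act-zeroSeq (a ∷ p) n rewrite act-zeroSeq p (suc n) | ℤP.*-zeroʳ a = refl

  act-⊛ : ∀ p q f n → act (p ⊛ q) f n ≡ act p (act q f) n
  act-⊛ [] q f n = refl
  act-⊛ (a ∷ p) q f n =
    trans (act-⊕ (a · q) (0ℤ ∷ (p ⊛ q)) f n)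
     (cong₂ _+_ (act-· a q f n) (trans (act-0∷ (p ⊛ q) f n) (act-⊛ p q f (suc n))))

  act-comm : ∀ p q f n → act p (act q f) n ≡ act q (act p f) n
  act-comm [] q f n = sym (act-zeroSeq q n)
  act-comm (a ∷ p) q f n =
    trans (cong (_+_ (a * act q f n))
             (trans (act-comm p q f (suc n)) (act-shift q (act p f) n)))
          (sym (trans (act-pointwise-+ q (λ m → a * f m) (λ m → act p f (suc m)) n)
                      (cong (_+ act q (λ m → act p f (suc m)) n) (act-pointwise-* q a f n))))

  infix 4 _≈_
  _≈_ : Poly → Poly → Set
  p ≈ q = ∀ f n → act p f n ≡ act q f n

  𝟘 𝟙 : Poly
  𝟘 = []
  𝟙 = 1ℤ ∷ []

  act-𝟙 : ∀ f n → act 𝟙 f n ≡ f n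
  act-𝟙 f n = trans (ℤP.+-identityʳ _) (ℤP.*-identityˡ _)

  ⊕-cong : ∀ {p p' q q'} → p ≈ p' → q ≈ q' → p ⊕ q ≈ p' ⊕ q'
  ⊕-cong {p} {p'} {q} {q'} e₁ e₂ f n =
    trans (act-⊕ p q f n) (trans (cong₂ _+_ (e₁ f n) (e₂ f n)) (sym (act-⊕ p' q' f n)))

  ⊕-assoc : ∀ p q r → (p ⊕ q) ⊕ r ≈ p ⊕ (q ⊕ r)
  ⊕-assoc p q r f n =
    trans (act-⊕ (p ⊕ q) r f n) (trans (cong (_+ act r f n) (act-⊕ p q f n))
      (trans (ℤP.+-assoc (act p f n) (act q f n) (act r f n))
        (sym (trans (act-⊕ p (q ⊕ r) f n) (cong (_+_ (act p f n)) (act-⊕ q r f n))))))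

  ⊕-comm : ∀ p q → p ⊕ q ≈ q ⊕ p
  ⊕-comm p q f n = trans (act-⊕ p q f n) (trans (ℤP.+-comm (act p f n) (act q f n)) (sym (act-⊕ q p f n)))

  ⊕-identityʳ : ∀ p → p ⊕ 𝟘 ≈ p
  ⊕-identityʳ p f n = trans (act-⊕ p 𝟘 f n) (ℤP.+-identityʳ (act p f n))

  ⊖-cong : ∀ {p q} → p ≈ q → ⊖ p ≈ ⊖ q
  ⊖-cong {p} {q} e f n = trans (act-⊖ p f n) (trans (cong -_ (e f n)) (sym (act-⊖ q f n)))

  ⊖-inverseˡ : ∀ p → ⊖ p ⊕ p ≈ 𝟘
  ⊖-inverseˡ p f n =
    trans (act-⊕ (⊖ p) p f n) (trans (cong (_+ act p f n) (act-⊖ p f n)) (ℤP.+-inverseˡ (act p f n)))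

  ⊖-inverseʳ : ∀ p → p ⊕ ⊖ p ≈ 𝟘
  ⊖-inverseʳ p f n =
    trans (act-⊕ p (⊖ p) f n) (trans (cong (_+_ (act p f n)) (act-⊖ p f n)) (ℤP.+-inverseʳ (act p f n)))

  ⊛-cong : ∀ {p p' q q'} → p ≈ p' → q ≈ q' → p ⊛ q ≈ p' ⊛ q'
  ⊛-cong {p} {p'} {q} {q'} e₁ e₂ f n =
    trans (act-⊛ p q f n) (trans (e₁ (act q f) n) (trans (act-cong p' (e₂ f) n) (sym (act-⊛ p' q' f n))))

  ⊛-assoc : ∀ p q r → (p ⊛ q) ⊛ r ≈ p ⊛ (q ⊛ r)
  ⊛-assoc p q r f n =
    trans (act-⊛ (p ⊛ q) r f n) (trans (act-⊛ p q (act r f) n)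
      (sym (trans (act-⊛ p (q ⊛ r) f n) (act-cong p (act-⊛ q r f) n))))

  ⊛-comm : ∀ p q → p ⊛ q ≈ q ⊛ p
  ⊛-comm p q f n = trans (act-⊛ p q f n) (trans (act-comm p q f n) (sym (act-⊛ q p f n)))

  ⊛-identityˡ : ∀ p → 𝟙 ⊛ p ≈ p
  ⊛-identityˡ p f n = trans (act-⊛ 𝟙 p f n) (act-𝟙 (act p f) n)

  ⊛-identityʳ : ∀ p → p ⊛ 𝟙 ≈ p
  ⊛-identityʳ p f n = trans (act-⊛ p 𝟙 f n) (act-cong p (act-𝟙 f) n)

  ⊛-distribˡ : ∀ p q r → p ⊛ (q ⊕ r) ≈ (p ⊛ q) ⊕ (p ⊛ r)
  ⊛-distribˡ p q r f n =
    trans (act-⊛ p (q ⊕ r) f n) (trans (act-cong p (act-⊕ q r f) n)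
      (trans (act-pointwise-+ p (act q f) (act r f) n)
        (sym (trans (act-⊕ (p ⊛ q) (p ⊛ r) f n) (cong₂ _+_ (act-⊛ p q f n) (act-⊛ p r f n))))))

  ⊛-distribʳ : ∀ p q r → (q ⊕ r) ⊛ p ≈ (q ⊛ p) ⊕ (r ⊛ p)
  ⊛-distribʳ p q r f n =
    trans (act-⊛ (q ⊕ r) p f n) (trans (act-⊕ q r (act p f) n)
      (sym (trans (act-⊕ (q ⊛ p) (r ⊛ p) f n) (cong₂ _+_ (act-⊛ q p f n) (act-⊛ r p f n)))))

  shift-isCommutativeRing : IsCommutativeRing _≈_ _⊕_ _⊛_ ⊖_ 𝟘 𝟙
  shift-isCommutativeRing = record
    { isRing = record
      { +-isAbelianGroup = record
        { isGroup = record
          { isMonoid = record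
            { isSemigroup = record
              { isMagma = record
                { isEquivalence = record
                  { refl = λ f n → refl
                  ; sym = λ e f n → sym (e f n)
                  ; trans = λ e₁ e₂ f n → trans (e₁ f n) (e₂ f n) }
                ; ∙-cong = λ {p} {p'} {q} {q'} → ⊕-cong {p} {p'} {q} {q'} }
              ; assoc = ⊕-assoc }
            ; identity = (λ p f n → refl) , ⊕-identityʳ }
          ; inverse = ⊖-inverseˡ , ⊖-inverseʳ
          ; ⁻¹-cong = λ {p} {q} → ⊖-cong {p} {q} }
        ; comm = ⊕-comm }
      ; *-cong = λ {p} {p'} {q} {q'} → ⊛-cong {p} {p'} {q} {q'}
      ; *-assoc = ⊛-assoc
      ; *-identity = ⊛-identityˡ , ⊛-identityʳ
      ; distrib = ⊛-distribˡ , ⊛-distribʳ }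
    ; *-comm = ⊛-comm }

  shiftRing : CommutativeRing 0ℓ 0ℓ
  shiftRing = record { isCommutativeRing = shift-isCommutativeRing }

module Determinant {c ℓ} (R : CommutativeRing c ℓ) where

  open CommutativeRing R hiding (zero)
  open import Algebra.Properties.Ring ring using (-0#≈0#; -‿involutive; -‿distribʳ-*)
  open import Data.Nat as ℕ using (ℕ; zero; suc; _<_; _≤_; z≤n; s≤s)
  import Data.Nat.Properties as ℕP
  open import Relation.Binary.PropositionalEquality as P using (_≡_; _≢_)
  open import Relation.Nullary using (yes; no)
  open import Data.Empty using (⊥-elim)
  open import Data.Sum using (_⊎_; inj₁; inj₂)
  open import Data.Product using (Σ; _×_; _,_)
  import Relation.Binary.Reasoning.Setoid as ≈-Reasoning
  open import Relation.Binary.Definitions using (tri<; tri≈; tri>)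
  import Tactic.RingSolver.Core.AlmostCommutativeRing as ACR
  open import Data.Maybe using (nothing)

  private
    acr : ACR.AlmostCommutativeRing c ℓ
    acr = ACR.fromCommutativeRing R (λ _ → nothing)
  open import Tactic.RingSolver.NonReflective acr using (solve; _⊜_; _⊕_; _⊗_; ⊝_)

  -- det n A only reads the leading n × n block of A and expands along row 0; skip i enumerates
  -- ℕ ∖ {i} in order, and altΣ n f = f 0 − f 1 + ⋯ ± f (n − 1).
  Mat : Set c
  Mat = ℕ → ℕ → Carrier

  skip : ℕ → ℕ → ℕ
  skip zero r = suc r
  skip (suc i) zero = zero
  skip (suc i) (suc r) = suc (skip i r)

  unskip : ℕ → ℕ → ℕ
  unskip zero zero = zero
  unskip zero (suc c) = c
  unskip (suc j) zero = zero
  unskip (suc j) (suc c) = suc (unskip j c)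

  minor : ℕ → ℕ → Mat → Mat
  minor i j A r c = A (skip i r) (skip j c)

  altΣ : ℕ → (ℕ → Carrier) → Carrier
  altΣ zero f = 0#
  altΣ (suc n) f = f 0 - altΣ n (λ j → f (suc j))

  det : ℕ → Mat → Carrier
  det zero A = 1#
  det (suc n) A = altΣ (suc n) (λ j → A 0 j * det n (minor 0 j A))

  negate^ : ℕ → Carrier → Carrier
  negate^ zero x = x
  negate^ (suc k) x = - negate^ k x

  private
    +-sub-interchange : ∀ a b A B → (a + b) - (A + B) ≈ (a - A) + (b - B)
    +-sub-interchange = solve 4 (λ a b A B → ((a ⊕ b) ⊕ (⊝ (A ⊕ B))) ⊜ ((a ⊕ (⊝ A)) ⊕ (b ⊕ (⊝ B)))) refl
    neg-sub-neg : ∀ a A → (- a) - (- A) ≈ - (a - A)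
    neg-sub-neg = solve 2 (λ a A → ((⊝ a) ⊕ (⊝ (⊝ A))) ⊜ (⊝ (a ⊕ (⊝ A)))) refl
    *-distribˡ-sub : ∀ x a A → x * (a - A) ≈ x * a - x * A
    *-distribˡ-sub x a A = trans (distribˡ x a (- A)) (+-congˡ (sym (-‿distribʳ-* x A)))
    *-leftCommute : ∀ a b d → a * (b * d) ≈ b * (a * d)
    *-leftCommute = solve 3 (λ a b d → (a ⊗ (b ⊗ d)) ⊜ (b ⊗ (a ⊗ d))) refl
    0-0≈0 : 0# - 0# ≈ 0#
    0-0≈0 = trans (+-congˡ -0#≈0#) (+-identityʳ 0#)

  altΣ-cong : ∀ n {f g} → (∀ j → j < n → f j ≈ g j) → altΣ n f ≈ altΣ n g
  altΣ-cong zero e = refl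
  altΣ-cong (suc n) e = +-cong (e 0 (s≤s z≤n)) (-‿cong (altΣ-cong n (λ j lt → e (suc j) (s≤s lt))))

  altΣ-+ : ∀ n f g → altΣ n (λ j → f j + g j) ≈ altΣ n f + altΣ n g
  altΣ-+ zero f g = sym (+-identityˡ 0#)
  altΣ-+ (suc n) f g =
    trans (+-congˡ (-‿cong (altΣ-+ n (λ j → f (suc j)) (λ j → g (suc j)))))
          (+-sub-interchange (f 0) (g 0) _ _)

  altΣ-neg : ∀ n f → altΣ n (λ j → - f j) ≈ - altΣ n f
  altΣ-neg zero f = sym -0#≈0#
  altΣ-neg (suc n) f =
    trans (+-congˡ (-‿cong (altΣ-neg n (λ j → f (suc j))))) (neg-sub-neg (f 0) _)

  altΣ-*l : ∀ n x f → x * altΣ n f ≈ altΣ n (λ j → x * f j)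
  altΣ-*l zero x f = zeroʳ x
  altΣ-*l (suc n) x f =
    trans (*-distribˡ-sub x (f 0) _) (+-congˡ (-‿cong (altΣ-*l n x (λ j → f (suc j)))))

  altΣ-0 : ∀ n f → (∀ j → j < n → f j ≈ 0#) → altΣ n f ≈ 0#
  altΣ-0 zero f e = refl
  altΣ-0 (suc n) f e =
    trans (+-cong (e 0 (s≤s z≤n)) (-‿cong (altΣ-0 n (λ j → f (suc j)) (λ j lt → e (suc j) (s≤s lt))))) 0-0≈0

  altΣ-sub : ∀ n f g → altΣ n (λ j → f j - g j) ≈ altΣ n f - altΣ n g
  altΣ-sub n f g = trans (altΣ-+ n f (λ j → - g j)) (+-congˡ (altΣ-neg n g))

  altΣ-swap : ∀ n m (g : ℕ → ℕ → Carrier) →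
    altΣ n (λ j → altΣ m (λ i → g j i)) ≈ altΣ m (λ i → altΣ n (λ j → g j i))
  altΣ-swap zero m g = sym (altΣ-0 m (λ i → 0#) (λ i _ → refl))
  altΣ-swap (suc n) m g =
    trans (+-congˡ (-‿cong (altΣ-swap n m (λ j i → g (suc j) i))))
          (sym (altΣ-sub m (λ i → g 0 i) (λ i → altΣ n (λ j → g (suc j) i))))

  altΣ-adjacentPair : ∀ n c f → (∀ j → j < n → j ≢ c → j ≢ suc c → f j ≈ 0#) →
    f c ≈ f (suc c) → suc c < n → altΣ n f ≈ 0#
  altΣ-adjacentPair (suc (suc n)) zero f h e lt =
    trans (+-congˡ (-‿cong (+-congˡ (-‿cong
            (altΣ-0 n (λ j → f (suc (suc j)))
              (λ j lt → h (suc (suc j)) (s≤s (s≤s lt)) (λ ()) (λ ())))))))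
      (trans (+-cong e (-‿cong (trans (+-congˡ -0#≈0#) (+-identityʳ _)))) (-‿inverseʳ _))
  altΣ-adjacentPair (suc n) (suc c) f h e (s≤s lt) =
    trans (+-cong (h 0 (s≤s z≤n) (λ ()) (λ ()))
            (-‿cong (altΣ-adjacentPair n c (λ j → f (suc j))
               (λ j jlt ne1 ne2 → h (suc j) (s≤s jlt) (λ q → ne1 (ℕP.suc-injective q))
                  (λ q → ne2 (ℕP.suc-injective q))) e lt)))
          0-0≈0

  skip-< : ∀ j c → c < j → skip j c ≡ c
  skip-< (suc j) zero lt = P.refl
  skip-< (suc j) (suc c) (s≤s lt) = P.cong suc (skip-< j c lt)

  skip-≥ : ∀ j c → j ≤ c → skip j c ≡ suc c
  skip-≥ zero c _ = P.refl
  skip-≥ (suc j) (suc c) (s≤s le) = P.cong suc (skip-≥ j c le)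

  skip-≢ : ∀ j c → skip j c ≢ j
  skip-≢ zero c ()
  skip-≢ (suc j) zero ()
  skip-≢ (suc j) (suc c) e = skip-≢ j c (ℕP.suc-injective e)

  unskip-skip : ∀ j c → unskip j (skip j c) ≡ c
  unskip-skip zero c = P.refl
  unskip-skip (suc j) zero = P.refl
  unskip-skip (suc j) (suc c) = P.cong suc (unskip-skip j c)

  skip-unskip : ∀ j c → c ≢ j → skip j (unskip j c) ≡ c
  skip-unskip zero zero ne = ⊥-elim (ne P.refl)
  skip-unskip zero (suc c) ne = P.refl
  skip-unskip (suc j) zero ne = P.refl
  skip-unskip (suc j) (suc c) ne = P.cong suc (skip-unskip j c (λ e → ne (P.cong suc e)))

  unskip-< : ∀ n j c → c ≢ j → c < suc n → j < suc n → unskip j c < n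
  unskip-< n zero zero ne _ _ = ⊥-elim (ne P.refl)
  unskip-< n zero (suc c) ne (s≤s lt) _ = lt
  unskip-< (suc n) (suc j) zero ne _ _ = s≤s z≤n
  unskip-< (suc n) (suc j) (suc c) ne (s≤s lt1) (s≤s lt2) =
    s≤s (unskip-< n j c (λ e → ne (P.cong suc e)) lt1 lt2)
  unskip-< zero (suc j) c ne _ (s≤s ())

  skip-suc : ∀ c x → (skip c x ≡ skip (suc c) x) ⊎ (x ≡ c)
  skip-suc zero zero = inj₂ P.refl
  skip-suc zero (suc x) = inj₁ P.refl
  skip-suc (suc c) zero = inj₁ P.refl
  skip-suc (suc c) (suc x) with skip-suc c x
  ... | inj₁ e = inj₁ (P.cong suc e)
  ... | inj₂ e = inj₂ (P.cong suc e)

  skip-self : ∀ c → skip c c ≡ suc c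
  skip-self c = skip-≥ c c ℕP.≤-refl

  skip-suc-self : ∀ c → skip (suc c) c ≡ c
  skip-suc-self c = skip-< (suc c) c ℕP.≤-refl

  det-cong : ∀ n {A B : Mat} → (∀ r c → A r c ≈ B r c) → det n A ≈ det n B
  det-cong zero e = refl
  det-cong (suc n) e =
    altΣ-cong (suc n) (λ j _ → *-cong (e 0 j) (det-cong n (λ r c → e (suc r) (skip j c))))

  det-lin : ∀ n k {A B C : Mat} → k < n →
    (∀ r j → j ≢ k → A r j ≈ B r j) → (∀ r j → j ≢ k → A r j ≈ C r j) →
    (∀ r → A r k ≈ B r k + C r k) → det n A ≈ det n B + det n C
  det-lin (suc n) k {A} {B} {C} klt hB hC hk =
    trans (altΣ-cong (suc n) split-term)
      (altΣ-+ (suc n) (λ j → B 0 j * det n (minor 0 j B)) (λ j → C 0 j * det n (minor 0 j C)))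
    where
    split-term : ∀ j → j < suc n → A 0 j * det n (minor 0 j A) ≈
                 B 0 j * det n (minor 0 j B) + C 0 j * det n (minor 0 j C)
    split-term j jlt with j ℕ.≟ k
    ... | yes P.refl =
      trans (*-cong (hk 0) refl)
       (trans (distribʳ _ _ _)
         (+-cong (*-congˡ (det-cong n (λ r c → hB (suc r) (skip j c) (skip-≢ j c))))
                 (*-congˡ (det-cong n (λ r c → hC (suc r) (skip j c) (skip-≢ j c))))))
    ... | no ne =
      trans (*-congˡ minor-splits) (trans (distribˡ _ _ _)
        (+-cong (*-congʳ (hB 0 j ne)) (*-congʳ (hC 0 j ne))))
      where
      k' = unskip j k
      k'lt : k' < n
      k'lt = unskip-< n j k (λ e → ne (P.sym e)) klt jlt
      minor-agrees-off : ∀ {X Y : Mat} → (∀ r j → j ≢ k → X r j ≈ Y r j) →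
            ∀ r c → c ≢ k' → minor 0 j X r c ≈ minor 0 j Y r c
      minor-agrees-off h r c ne2 = h (suc r) (skip j c)
        (λ e → ne2 (P.trans (P.sym (unskip-skip j c)) (P.cong (unskip j) e)))
      minor-splits-at : ∀ r → minor 0 j A r k' ≈ minor 0 j B r k' + minor 0 j C r k'
      minor-splits-at r rewrite skip-unskip j k (λ e → ne (P.sym e)) = hk (suc r)
      minor-splits : det n (minor 0 j A) ≈ det n (minor 0 j B) + det n (minor 0 j C)
      minor-splits = det-lin n k' k'lt (minor-agrees-off hB) (minor-agrees-off hC) minor-splits-at

  minor-adjacentEqualColumns : ∀ n c j (A : Mat) → suc c < suc n → j < suc n → j ≢ c → j ≢ suc c →
    (∀ r → A r c ≈ A r (suc c)) →
    Σ ℕ λ c' → suc c' < n × (∀ r → minor 0 j A r c' ≈ minor 0 j A r (suc c'))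
  minor-adjacentEqualColumns n c j A lt jlt ne₁ ne₂ e with ℕP.<-cmp j c
  ... | tri≈ _ j≡c _ = ⊥-elim (ne₁ j≡c)
  minor-adjacentEqualColumns n zero j A lt jlt ne₁ ne₂ e | tri< () _ _
  minor-adjacentEqualColumns n (suc c) j A (s≤s lt) jlt ne₁ ne₂ e | tri< (s≤s j≤c) _ _ =
    c , lt , λ r → trans (reflexive (P.cong (A (suc r)) (skip-≥ j c j≤c)))
                     (trans (e (suc r)) (reflexive (P.cong (A (suc r)) (P.sym (skip-≥ j (suc c) (ℕP.m≤n⇒m≤1+n j≤c))))))
  ... | tri> _ _ c<j = c , sc<n , λ r → trans (reflexive (P.cong (A (suc r)) (skip-< j c c<j)))
                         (trans (e (suc r)) (reflexive (P.cong (A (suc r)) (P.sym (skip-< j (suc c) sc<j)))))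
    where
    sc<j : suc c < j
    sc<j = ℕP.≤∧≢⇒< c<j (λ q → ne₂ (P.sym q))
    sc<n : suc c < n
    sc<n = ℕP.<-≤-trans sc<j (ℕP.≤-pred jlt)

  det-adjacentEqualColumns : ∀ n c (A : Mat) → suc c < n → (∀ r → A r c ≈ A r (suc c)) → det n A ≈ 0#
  det-adjacentEqualColumns (suc n) c A lt e = altΣ-adjacentPair (suc n) c t h pair lt
    where
    t : ℕ → Carrier
    t j = A 0 j * det n (minor 0 j A)
    h : ∀ j → j < suc n → j ≢ c → j ≢ suc c → t j ≈ 0#
    h j jlt ne₁ ne₂ with minor-adjacentEqualColumns n c j A lt jlt ne₁ ne₂ e
    ... | c' , c'lt , e' = trans (*-congˡ (det-adjacentEqualColumns n c' (minor 0 j A) c'lt e')) (zeroʳ _)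
    minors-agree : ∀ r x → minor 0 c A r x ≈ minor 0 (suc c) A r x
    minors-agree r x with skip-suc c x
    ... | inj₁ q = reflexive (P.cong (A (suc r)) q)
    ... | inj₂ P.refl = trans (reflexive (P.cong (A (suc r)) (skip-self c)))
                          (trans (sym (e (suc r))) (reflexive (P.cong (A (suc r)) (P.sym (skip-suc-self c)))))
    pair : t c ≈ t (suc c)
    pair = *-cong (e 0) (det-cong n minors-agree)

  open import Algebra.Properties.Group +-group using (inverseˡ-unique)

  setColumn : ℕ → (ℕ → Carrier) → Mat → Mat
  setColumn k u A r j with j ℕ.≟ k
  ... | yes _ = u r
  ... | no _ = A r j

  setColumn-same : ∀ k u A r → setColumn k u A r k ≡ u r
  setColumn-same k u A r with k ℕ.≟ k
  ... | yes _ = P.refl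
  ... | no ne = ⊥-elim (ne P.refl)

  setColumn-other : ∀ k u A r j → j ≢ k → setColumn k u A r j ≡ A r j
  setColumn-other k u A r j ne with j ℕ.≟ k
  ... | yes e = ⊥-elim (ne e)
  ... | no _ = P.refl

  swap : ℕ → ℕ → ℕ
  swap c j with j ℕ.≟ c
  ... | yes _ = suc c
  ... | no _ with j ℕ.≟ suc c
  ...   | yes _ = c
  ...   | no _ = j

  swap-self : ∀ c → swap c c ≡ suc c
  swap-self c with c ℕ.≟ c
  ... | yes _ = P.refl
  ... | no ne = ⊥-elim (ne P.refl)

  swap-suc : ∀ c → swap c (suc c) ≡ c
  swap-suc c with suc c ℕ.≟ c
  ... | yes e = ⊥-elim (ℕP.1+n≢n e)
  ... | no _ with suc c ℕ.≟ suc c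
  ...   | yes _ = P.refl
  ...   | no ne = ⊥-elim (ne P.refl)

  swap-other : ∀ c j → j ≢ c → j ≢ suc c → swap c j ≡ j
  swap-other c j n1 n2 with j ℕ.≟ c
  ... | yes e = ⊥-elim (n1 e)
  ... | no _ with j ℕ.≟ suc c
  ...   | yes e = ⊥-elim (n2 e)
  ...   | no _ = P.refl

  ≡⊎≢ : ∀ (j c : ℕ) → (j ≡ c) ⊎ (j ≢ c)
  ≡⊎≢ j c with j ℕ.≟ c
  ... | yes e = inj₁ e
  ... | no ne = inj₂ ne

  module ColumnPair (A : Mat) (c : ℕ) where

    pair : (ℕ → Carrier) → (ℕ → Carrier) → Mat
    pair u w = setColumn c u (setColumn (suc c) w A)

    pair-c : ∀ u w r → pair u w r c ≡ u r
    pair-c u w r = setColumn-same c u _ r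

    pair-suc : ∀ u w r → pair u w r (suc c) ≡ w r
    pair-suc u w r = P.trans (setColumn-other c u _ r (suc c) ℕP.1+n≢n) (setColumn-same (suc c) w A r)

    pair-other : ∀ u w r j → j ≢ c → j ≢ suc c → pair u w r j ≡ A r j
    pair-other u w r j ne₁ ne₂ = P.trans (setColumn-other c u _ r j ne₁) (setColumn-other (suc c) w A r j ne₂)

    pair-offSuc : ∀ u w w' r j → j ≢ suc c → pair u w r j ≡ pair u w' r j
    pair-offSuc u w w' r j ne with ≡⊎≢ j c
    ... | inj₁ P.refl = P.trans (pair-c u w r) (P.sym (pair-c u w' r))
    ... | inj₂ ne₂ = P.trans (pair-other u w r j ne₂ ne) (P.sym (pair-other u w' r j ne₂ ne))

    det-pair-diagonal : ∀ n → suc c < n → ∀ u → det n (pair u u) ≈ 0#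
    det-pair-diagonal n lt u =
      det-adjacentEqualColumns n c (pair u u) lt (λ r → reflexive (P.trans (pair-c u u r) (P.sym (pair-suc u u r))))

    det-pair-+ˡ : ∀ n → c < n → ∀ u u' w → det n (pair (λ r → u r + u' r) w) ≈ det n (pair u w) + det n (pair u' w)
    det-pair-+ˡ n c<n u u' w = det-lin n c c<n
      (λ r j ne → reflexive (P.trans (setColumn-other c _ _ r j ne) (P.sym (setColumn-other c _ _ r j ne))))
      (λ r j ne → reflexive (P.trans (setColumn-other c _ _ r j ne) (P.sym (setColumn-other c _ _ r j ne))))
      (λ r → reflexive (P.trans (pair-c _ w r) (P.sym (P.cong₂ _+_ (pair-c u w r) (pair-c u' w r)))))

    det-pair-+ʳ : ∀ n → suc c < n → ∀ u w w' → det n (pair u (λ r → w r + w' r)) ≈ det n (pair u w) + det n (pair u w')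
    det-pair-+ʳ n lt u w w' = det-lin n (suc c) lt
      (λ r j ne → reflexive (pair-offSuc u _ w r j ne))
      (λ r j ne → reflexive (pair-offSuc u _ w' r j ne))
      (λ r → reflexive (P.trans (pair-suc u _ r) (P.sym (P.cong₂ _+_ (pair-suc u w r) (pair-suc u w' r)))))

    column : ℕ → ℕ → Carrier
    column j r = A r j

    A≈pair : ∀ r j → A r j ≈ pair (column c) (column (suc c)) r j
    A≈pair r j with ≡⊎≢ j c
    ... | inj₁ P.refl = reflexive (P.sym (pair-c _ _ r))
    ... | inj₂ ne₁ with ≡⊎≢ j (suc c)
    ...   | inj₁ P.refl = reflexive (P.sym (pair-suc _ _ r))
    ...   | inj₂ ne₂ = reflexive (P.sym (pair-other _ _ r j ne₁ ne₂))

    swapped≈pair : ∀ r j → A r (swap c j) ≈ pair (column (suc c)) (column c) r j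
    swapped≈pair r j with ≡⊎≢ j c
    ... | inj₁ P.refl = reflexive (P.trans (P.cong (A r) (swap-self c)) (P.sym (pair-c _ _ r)))
    ... | inj₂ ne₁ with ≡⊎≢ j (suc c)
    ...   | inj₁ P.refl = reflexive (P.trans (P.cong (A r) (swap-suc c)) (P.sym (pair-suc _ _ r)))
    ...   | inj₂ ne₂ = reflexive (P.trans (P.cong (A r) (swap-other c j ne₁ ne₂)) (P.sym (pair-other _ _ r j ne₁ ne₂)))

  -- Alternation from multilinearity: with a, b the columns c, c+1, the vanishing determinant
  -- det(a+b, a+b) expands to det(a,a) + det(a,b) + det(b,a) + det(b,b) = det(a,b) + det(b,a).
  det-swap : ∀ n c (A : Mat) → suc c < n → det n A ≈ - det n (λ r j → A r (swap c j))
  det-swap n c A lt = inverseˡ-unique _ _ (begin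
    det n A + det n (λ r j → A r (swap c j))
      ≈⟨ +-cong (det-cong n A≈pair) (det-cong n swapped≈pair) ⟩
    det n (pair a b) + det n (pair b a)
      ≈⟨ +-cong (sym (trans (+-congʳ (zero-diag a)) (+-identityˡ _))) (sym (trans (+-congˡ (zero-diag b)) (+-identityʳ _))) ⟩
    (det n (pair a a) + det n (pair a b)) + (det n (pair b a) + det n (pair b b))
      ≈⟨ +-cong (sym (det-pair-+ʳ n lt a a b)) (sym (det-pair-+ʳ n lt b a b)) ⟩
    det n (pair a a+b) + det n (pair b a+b)
      ≈⟨ sym (det-pair-+ˡ n (ℕP.<-trans (ℕP.n<1+n c) lt) a b a+b) ⟩
    det n (pair a+b a+b)
      ≈⟨ zero-diag a+b ⟩
    0# ∎)
    where
    open ColumnPair A c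
    open ≈-Reasoning setoid
    a b a+b : ℕ → Carrier
    a = column c
    b = column (suc c)
    a+b r = a r + b r
    zero-diag : ∀ u → det n (pair u u) ≈ 0#
    zero-diag = det-pair-diagonal n lt

  det-equalColumns : ∀ n c d (A : Mat) → c < d → d < n → (∀ r → A r c ≈ A r d) → det n A ≈ 0#
  det-equalColumns n c (suc d) A c<d dlt e with ≡⊎≢ c d
  ... | inj₁ P.refl = det-adjacentEqualColumns n c A dlt e
  ... | inj₂ ne = trans (det-swap n d A dlt) (trans (-‿cong swapped-vanishes) -0#≈0#)
    where
    c<d' : c < d
    c<d' = ℕP.≤∧≢⇒< (ℕP.≤-pred c<d) ne
    A' : Mat
    A' r j = A r (swap d j)
    swapped-vanishes : det n A' ≈ 0#
    swapped-vanishes = det-equalColumns n c d A' c<d' (ℕP.<-trans (ℕP.n<1+n d) dlt)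
      (λ r → trans (reflexive (P.cong (A r) (swap-other d c ne (λ q → ℕP.<⇒≢ (ℕP.<-trans c<d' (ℕP.n<1+n d)) q))))
              (trans (e r) (reflexive (P.cong (A r) (P.sym (swap-self d))))))

  det-expandColumn0 : ∀ n (A : Mat) → det (suc n) A ≈ altΣ (suc n) (λ i → A i 0 * det n (minor i 0 A))
  det-expandColumn0 zero A = refl
  det-expandColumn0 (suc m) A = +-congˡ (-‿cong inner)
    where
    D : ℕ → ℕ → Carrier
    D i j = det m (λ r c → A (suc (skip i r)) (suc (skip j c)))
    inner : altΣ (suc m) (λ j → A 0 (suc j) * det (suc m) (minor 0 (suc j) A)) ≈
            altΣ (suc m) (λ i → A (suc i) 0 * det (suc m) (minor (suc i) 0 A))
    inner = trans (altΣ-cong (suc m) (λ j _ →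
                     trans (*-congˡ (det-expandColumn0 m (minor 0 (suc j) A)))
                           (altΣ-*l (suc m) (A 0 (suc j)) (λ i → A (suc i) 0 * D i j))))
            (trans (altΣ-swap (suc m) (suc m) (λ j i → A 0 (suc j) * (A (suc i) 0 * D i j)))
            (altΣ-cong (suc m) (λ i _ →
               trans (altΣ-cong (suc m) (λ j _ → *-leftCommute (A 0 (suc j)) (A (suc i) 0) (D i j)))
                     (sym (altΣ-*l (suc m) (A (suc i) 0) (λ j → A 0 (suc j) * D i j))))))

  negate^-cong : ∀ k {x y} → x ≈ y → negate^ k x ≈ negate^ k y
  negate^-cong zero e = e
  negate^-cong (suc k) e = -‿cong (negate^-cong k e)

  negate^-neg : ∀ k x → negate^ k (- x) ≈ - negate^ k x
  negate^-neg zero x = refl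
  negate^-neg (suc k) x = -‿cong (negate^-neg k x)

  negate^-0 : ∀ k → negate^ k 0# ≈ 0#
  negate^-0 zero = refl
  negate^-0 (suc k) = trans (-‿cong (negate^-0 k)) -0#≈0#

  swap-skip : ∀ k c → swap k (skip k c) ≡ skip (suc k) c
  swap-skip k c with ℕP.<-cmp c k
  ... | tri< c<k _ _ = P.trans (P.cong (swap k) (skip-< k c c<k))
         (P.trans (swap-other k c (ℕP.<⇒≢ c<k) (λ q → ℕP.<⇒≢ (ℕP.<-trans c<k (ℕP.n<1+n k)) q))
                  (P.sym (skip-< (suc k) c (ℕP.<-trans c<k (ℕP.n<1+n k)))))
  ... | tri≈ _ P.refl _ = P.trans (P.cong (swap c) (skip-self c)) (P.trans (swap-suc c) (P.sym (skip-suc-self c)))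
  ... | tri> _ _ k<c = P.trans (P.cong (swap k) (skip-≥ k c (ℕP.<⇒≤ k<c)))
         (P.trans (swap-other k (suc c) (λ q → ℕP.<⇒≢ (ℕP.<-trans k<c (ℕP.n<1+n c)) (P.sym q))
                     (λ q → ℕP.<⇒≢ k<c (P.sym (ℕP.suc-injective q))))
                  (P.sym (skip-≥ (suc k) c k<c)))

  det-expandColumn : ∀ n k (A : Mat) → k < suc n →
    altΣ (suc n) (λ i → A i k * det n (minor i k A)) ≈ negate^ k (det (suc n) A)
  det-expandColumn n zero A _ = sym (det-expandColumn0 n A)
  det-expandColumn n (suc k) A lt =
    trans (altΣ-cong (suc n) (λ i _ → *-cong (reflexive (P.cong (A i) (P.sym (swap-self k))))
             (det-cong n (λ r c → reflexive (P.cong (A (skip i r)) (P.sym (swap-skip k c)))))))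
    (trans (det-expandColumn n k A' (ℕP.<-trans (ℕP.n<1+n k) lt))
    (trans (negate^-cong k det-swapped) (negate^-neg k _)))
    where
    A' : Mat
    A' r j = A r (swap k j)
    det-swapped : det (suc n) A' ≈ - det (suc n) A
    det-swapped = trans (sym (-‿involutive _)) (-‿cong (sym (det-swap (suc n) k A lt)))

  -- Expanding with the cofactors of column k but the entries of column j ≠ k computes the
  -- determinant of a matrix whose columns j and k coincide.
  expandColumn-foreign : ∀ n k j (B : Mat) → k < suc n → j < suc n → j ≢ k →
    altΣ (suc n) (λ i → B i j * det n (minor i k B)) ≈ 0#
  expandColumn-foreign n k j B klt jlt ne =
    trans (altΣ-cong (suc n) (λ i _ → *-cong (reflexive (P.sym (setColumn-same k (λ r → B r j) B i)))
             (det-cong n (λ r c → reflexive (P.sym (setColumn-other k (λ r → B r j) B (skip i r) (skip k c) (skip-≢ k c)))))))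
    (trans (det-expandColumn n k A klt) (trans (negate^-cong k det-vanishes) (negate^-0 k)))
    where
    A : Mat
    A = setColumn k (λ r → B r j) B
    columns-agree : ∀ r → A r k ≡ A r j
    columns-agree r = P.trans (setColumn-same k _ B r) (P.sym (setColumn-other k _ B r j ne))
    det-vanishes : det (suc n) A ≈ 0#
    det-vanishes with ℕP.<-cmp j k
    ... | tri< j<k _ _ = det-equalColumns (suc n) j k A j<k klt (λ r → reflexive (P.sym (columns-agree r)))
    ... | tri≈ _ e _ = ⊥-elim (ne e)
    ... | tri> _ _ k<j = det-equalColumns (suc n) k j A k<j jlt (λ r → reflexive (columns-agree r))

module PolynomialDegree where

  open import Data.Integer using (ℤ; _+_; _*_; -_; 0ℤ)
  import Data.Integer.Properties as ℤP
  open import Data.Nat as ℕ using (ℕ; zero; suc; _<_; _≤_; z≤n; s≤s)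
  import Data.Nat.Properties as ℕP
  open import Data.List using ([]; _∷_)
  open import Relation.Binary.PropositionalEquality
  open ShiftOperator
  open IntegerRangeSum

  coeff : ℕ → Poly → ℤ
  coeff k [] = 0ℤ
  coeff zero (a ∷ p) = a
  coeff (suc k) (a ∷ p) = coeff k p

  coeff-⊕ : ∀ k p q → coeff k (p ⊕ q) ≡ coeff k p + coeff k q
  coeff-⊕ k [] q = sym (ℤP.+-identityˡ _)
  coeff-⊕ k (a ∷ p) [] = sym (ℤP.+-identityʳ _)
  coeff-⊕ zero (a ∷ p) (b ∷ q) = refl
  coeff-⊕ (suc k) (a ∷ p) (b ∷ q) = coeff-⊕ k p q

  coeff-⊖ : ∀ k p → coeff k (⊖ p) ≡ - coeff k p
  coeff-⊖ k [] = refl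
  coeff-⊖ zero (a ∷ p) = refl
  coeff-⊖ (suc k) (a ∷ p) = coeff-⊖ k p

  coeff-· : ∀ k c p → coeff k (c · p) ≡ c * coeff k p
  coeff-· k c [] = sym (ℤP.*-zeroʳ c)
  coeff-· zero c (a ∷ p) = refl
  coeff-· (suc k) c (a ∷ p) = coeff-· k c p

  DegreeLE : ℕ → Poly → Set
  DegreeLE d p = ∀ k → d < k → coeff k p ≡ 0ℤ

  IsZeroPoly : Poly → Set
  IsZeroPoly p = ∀ k → coeff k p ≡ 0ℤ

  coeff-⊛ : ∀ k a p q → coeff k ((a ∷ p) ⊛ q) ≡ a * coeff k q + coeff k (0ℤ ∷ (p ⊛ q))
  coeff-⊛ k a p q = trans (coeff-⊕ k (a · q) (0ℤ ∷ (p ⊛ q))) (cong (_+ coeff k (0ℤ ∷ (p ⊛ q))) (coeff-· k a q))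

  IsZeroPoly-⊛ : ∀ p q → IsZeroPoly p → IsZeroPoly (p ⊛ q)
  IsZeroPoly-⊛ [] q z k = refl
  IsZeroPoly-⊛ (a ∷ p) q z k = trans (coeff-⊛ k a p q)
    (cong₂ _+_ (cong (_* coeff k q) (z 0)) (tail-vanishes k))
    where
    tail-vanishes : ∀ k → coeff k (0ℤ ∷ (p ⊛ q)) ≡ 0ℤ
    tail-vanishes zero = refl
    tail-vanishes (suc k) = IsZeroPoly-⊛ p q (λ k → z (suc k)) k

  DegreeLE-⊛ : ∀ a b p q → DegreeLE a p → DegreeLE b q → DegreeLE (a ℕ.+ b) (p ⊛ q)
  DegreeLE-⊛ a b [] q dp dq k lt = refl
  DegreeLE-⊛ a b (x ∷ p) q dp dq k lt =
    trans (coeff-⊛ k x p q)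
      (cong₂ _+_ (trans (cong (x *_) (dq k (ℕP.<-≤-trans (ℕP.m≤n+m (suc b) a) (subst (_≤ k) (sym (ℕP.+-suc a b)) lt)))) (ℤP.*-zeroʳ x)) (tail-vanishes a k dp lt))
    where
    tail-vanishes : ∀ a k → DegreeLE a (x ∷ p) → a ℕ.+ b < k → coeff k (0ℤ ∷ (p ⊛ q)) ≡ 0ℤ
    tail-vanishes a zero _ ()
    tail-vanishes zero (suc k) dp _ = IsZeroPoly-⊛ p q (λ k → dp (suc k) (s≤s z≤n)) k
    tail-vanishes (suc a) (suc k) dp (s≤s lt) = DegreeLE-⊛ a b p q (λ k lt → dp (suc k) (s≤s lt)) dq k lt

  coeff-⊛-leading : ∀ a b p q → DegreeLE a p → DegreeLE b q → coeff (a ℕ.+ b) (p ⊛ q) ≡ coeff a p * coeff b q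
  coeff-⊛-leading a b [] q dp dq = refl
  coeff-⊛-leading zero b (x ∷ p) q dp dq =
    trans (coeff-⊛ b x p q) (trans (cong (_+_ (x * coeff b q)) (tail-vanishes b)) (ℤP.+-identityʳ _))
    where
    tail-vanishes : ∀ b → coeff b (0ℤ ∷ (p ⊛ q)) ≡ 0ℤ
    tail-vanishes zero = refl
    tail-vanishes (suc b) = IsZeroPoly-⊛ p q (λ k → dp (suc k) (s≤s z≤n)) b
  coeff-⊛-leading (suc a) b (x ∷ p) q dp dq =
    trans (coeff-⊛ (suc (a ℕ.+ b)) x p q)
     (trans (cong₂ _+_ (trans (cong (x *_) (dq _ (s≤s (ℕP.m≤n+m b a)))) (ℤP.*-zeroʳ x))
                       (coeff-⊛-leading a b p q (λ k lt → dp (suc k) (s≤s lt)) dq))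
            (ℤP.+-identityˡ _))

  DegreeLE-⊕ : ∀ d p q → DegreeLE d p → DegreeLE d q → DegreeLE d (p ⊕ q)
  DegreeLE-⊕ d p q dp dq k lt rewrite coeff-⊕ k p q | dp k lt | dq k lt = refl

  DegreeLE-⊖ : ∀ d p → DegreeLE d p → DegreeLE d (⊖ p)
  DegreeLE-⊖ d p dp k lt rewrite coeff-⊖ k p | dp k lt = refl

  act-IsZeroPoly : ∀ q f n → IsZeroPoly q → act q f n ≡ 0ℤ
  act-IsZeroPoly [] f n z = refl
  act-IsZeroPoly (a ∷ q) f n z rewrite z 0 | act-IsZeroPoly q f (suc n) (λ k → z (suc k)) = refl

  act-byCoefficients : ∀ d q f n → DegreeLE d q → act q f n ≡ sumℤ (suc d) (λ m → coeff m q * f (n ℕ.+ m))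
  act-byCoefficients d [] f n dq = sym (sumℤ-0 (suc d) _ (λ _ _ → refl))
  act-byCoefficients zero (a ∷ q) f n dq =
    cong₂ _+_ (cong (λ x → a * f x) (sym (ℕP.+-identityʳ n))) (act-IsZeroPoly q f (suc n) (λ k → dq (suc k) (s≤s z≤n)))
  act-byCoefficients (suc d) (a ∷ q) f n dq =
    cong₂ _+_ (cong (λ x → a * f x) (sym (ℕP.+-identityʳ n)))
     (trans (act-byCoefficients d q f (suc n) (λ k lt → dq (suc k) (s≤s lt)))
            (sumℤ-cong (suc d) (λ m _ → cong (λ x → coeff m q * f x) (sym (ℕP.+-suc n m)))))


module CayleyHamilton where

  open import Data.Integer using (ℤ; +_; _+_; _*_; -_; 0ℤ; 1ℤ)
  import Data.Integer.Properties as ℤP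
  open import Data.Nat as ℕ using (ℕ; zero; suc; _<_; _≤_; z≤n; s≤s)
  import Data.Nat.Properties as ℕP
  open import Data.List using ([]; _∷_)
  open import Data.Bool using (true; false; if_then_else_)
  open import Data.Product using (Σ; _,_)
  open import Relation.Binary.PropositionalEquality
  open import Data.Empty using (⊥-elim)
  open import Data.Integer.Tactic.RingSolver
  open import Algebra.Properties.AbelianGroup ℤP.+-0-abelianGroup using (inverseʳ-unique)
  open ≡-Reasoning
  open ShiftOperator
  open IntegerRangeSum
  open PolynomialDegree
  module PolyDet = Determinant shiftRing
  open PolyDet using (Mat; det; minor; skip; altΣ; negate^)
  module IntDet = Determinant ℤP.+-*-commutativeRing

  DegreeLE-altΣ : ∀ n e f → (∀ j → DegreeLE e (f j)) → DegreeLE e (altΣ n f)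
  DegreeLE-altΣ zero e f h k lt = refl
  DegreeLE-altΣ (suc n) e f h =
    DegreeLE-⊕ e (f 0) (⊖ altΣ n (λ j → f (suc j))) (h 0) (DegreeLE-⊖ e (altΣ n (λ j → f (suc j))) (DegreeLE-altΣ n e (λ j → f (suc j)) (λ j → h (suc j))))

  DegreeLE-det : ∀ n (A : Mat) → (∀ r c → DegreeLE 1 (A r c)) → DegreeLE n (det n A)
  DegreeLE-det zero A h (suc k) lt = refl
  DegreeLE-det (suc n) A h =
    DegreeLE-altΣ (suc n) (suc n) (λ j → A 0 j ⊛ det n (minor 0 j A)) (λ j → DegreeLE-⊛ 1 n (A 0 j) (det n (minor 0 j A)) (h 0 j)
       (DegreeLE-det n (minor 0 j A) (λ r c → h (suc r) (skip j c))))

  X : Poly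
  X = 0ℤ ∷ 1ℤ ∷ []

  charMat : (ℕ → ℕ → ℤ) → Mat
  charMat M r c = (if r ℕ.≡ᵇ c then X else []) ⊕ ⊖ (M r c ∷ [])

  DegreeLE-charMat : ∀ M r c → DegreeLE 1 (charMat M r c)
  DegreeLE-charMat M r c with r ℕ.≡ᵇ c
  ... | true = λ { (suc (suc k)) _ → refl ; (suc zero) (s≤s ()) ; zero () }
  ... | false = λ { (suc (suc k)) _ → refl ; (suc zero) _ → refl ; zero () }

  charPoly-monic : ∀ n M → coeff n (det n (charMat M)) ≡ 1ℤ
  charPoly-monic zero M = refl
  charPoly-monic (suc n) M =
    trans (coeff-⊕ (suc n) (t 0) (⊖ altΣ n (λ j → t (suc j))))
     (trans (cong₂ _+_ leading-term (trans (coeff-⊖ (suc n) (altΣ n (λ j → t (suc j)))) (cong -_ lower-terms-vanish))) refl)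
    where
    t : ℕ → Poly
    t j = charMat M 0 j ⊛ det n (minor 0 j (charMat M))
    M' : ℕ → ℕ → ℤ
    M' r c = M (suc r) (suc c)
    leading-term : coeff (suc n) (t 0) ≡ 1ℤ
    leading-term = trans (coeff-⊛-leading 1 n (charMat M 0 0) (det n (charMat M')) (DegreeLE-charMat M 0 0)
                 (DegreeLE-det n (charMat M') (DegreeLE-charMat M')))
               (cong (1ℤ *_) (charPoly-monic n M'))
    lower-terms : ∀ j → DegreeLE n (t (suc j))
    lower-terms j = DegreeLE-⊛ 0 n (charMat M 0 (suc j)) (det n (minor 0 (suc j) (charMat M))) (λ { (suc k) _ → refl })
             (DegreeLE-det n (minor 0 (suc j) (charMat M)) (λ r c → DegreeLE-charMat M (suc r) (skip (suc j) c)))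
    lower-terms-vanish : coeff (suc n) (altΣ n (λ j → t (suc j))) ≡ 0ℤ
    lower-terms-vanish = DegreeLE-altΣ n n (λ j → t (suc j)) lower-terms (suc n) ℕP.≤-refl

  sumℤ-altΣ : ∀ n m (h : ℕ → ℕ → ℤ) →
    sumℤ n (λ j → IntDet.altΣ m (λ i → h j i)) ≡ IntDet.altΣ m (λ i → sumℤ n (λ j → h j i))
  sumℤ-altΣ zero m h = sym (IntDet.altΣ-0 m (λ _ → 0ℤ) (λ _ _ → refl))
  sumℤ-altΣ (suc n) m h rewrite sumℤ-altΣ n m (λ j i → h (suc j) i) =
    sym (IntDet.altΣ-+ m (λ i → h 0 i) (λ i → sumℤ n (λ j → h (suc j) i)))

  act-altΣ : ∀ n f g k → act (altΣ n f) g k ≡ IntDet.altΣ n (λ i → act (f i) g k)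
  act-altΣ zero f g k = refl
  act-altΣ (suc n) f g k =
    trans (act-⊕ (f 0) (⊖ altΣ n (λ j → f (suc j))) g k)
     (cong (_+_ (act (f 0) g k)) (trans (act-⊖ (altΣ n (λ j → f (suc j))) g k)
        (cong -_ (act-altΣ n (λ j → f (suc j)) g k))))

  act-sum : ∀ p n (g : ℕ → Seq) k → act p (λ m → sumℤ n (λ j → g j m)) k ≡ sumℤ n (λ j → act p (g j) k)
  act-sum p zero g k = act-zeroSeq p k
  act-sum p (suc n) g k =
    trans (act-pointwise-+ p (g 0) (λ m → sumℤ n (λ j → g (suc j) m)) k)
          (cong (_+_ (act p (g 0) k)) (act-sum p n (λ j → g (suc j)) k))

  act-negate^ : ∀ c q f k → act (negate^ c q) f k ≡ 0ℤ → act q f k ≡ 0ℤ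
  act-negate^ zero q f k e = e
  act-negate^ (suc c) q f k e =
    act-negate^ c q f k (trans (sym (ℤP.neg-involutive _)) (trans (cong -_ (trans (sym (act-⊖ (negate^ c q) f k)) e)) refl))

  ≡ᵇ-refl : ∀ i → (i ℕ.≡ᵇ i) ≡ true
  ≡ᵇ-refl zero = refl
  ≡ᵇ-refl (suc i) = ≡ᵇ-refl i

  ≡ᵇ-≢ : ∀ i j → i ≢ j → (i ℕ.≡ᵇ j) ≡ false
  ≡ᵇ-≢ zero zero ne = ⊥-elim (ne refl)
  ≡ᵇ-≢ zero (suc j) ne = refl
  ≡ᵇ-≢ (suc i) zero ne = refl
  ≡ᵇ-≢ (suc i) (suc j) ne = ≡ᵇ-≢ i j (λ e → ne (cong suc e))

  act-charMat : ∀ M i j f k → act (charMat M i j) f k ≡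
    (if i ℕ.≡ᵇ j then f (suc k) else 0ℤ) + - (M i j * f k)
  act-charMat M i j f k with i ℕ.≡ᵇ j
  ... | true = trans (act-⊕ X (⊖ (M i j ∷ [])) f k)
                 (cong₂ _+_ (X-acts (f k) (f (suc k))) (trans (act-⊖ (M i j ∷ []) f k) (cong -_ (ℤP.+-identityʳ _))))
    where
    X-acts : ∀ a b → 0ℤ * a + (1ℤ * b + 0ℤ) ≡ b
    X-acts = solve-∀
  ... | false = trans (act-⊖ (M i j ∷ []) f k) (trans (cong -_ (ℤP.+-identityʳ (M i j * f k))) (sym (ℤP.+-identityˡ (- (M i j * f k)))))

  Solves : ℕ → (ℕ → ℕ → ℤ) → (ℕ → Seq) → Set
  Solves p M v = ∀ i → i < p → ∀ k → v i (suc k) ≡ sumℤ p (λ j → M i j * v j k)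

  charMat-row-annihilates : ∀ p M v → Solves p M v →
    ∀ i → i < p → ∀ n → sumℤ p (λ j → act (charMat M i j) (v j) n) ≡ 0ℤ
  charMat-row-annihilates p M v hv i ilt n = begin
    sumℤ p (λ j → act (charMat M i j) (v j) n)
      ≡⟨ sumℤ-cong p (λ j _ → act-charMat M i j (v j) n) ⟩
    sumℤ p (λ j → shifted j + - (M i j * v j n))
      ≡⟨ sumℤ-+ p shifted (λ j → - (M i j * v j n)) ⟩
    sumℤ p shifted + sumℤ p (λ j → - (M i j * v j n))
      ≡⟨ cong₂ _+_ (trans (sumℤ-single p i shifted ilt off-diagonal) on-diagonal) (sumℤ-neg p (λ j → M i j * v j n)) ⟩
    sumℤ p (λ j → M i j * v j n) + - sumℤ p (λ j → M i j * v j n)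
      ≡⟨ ℤP.+-inverseʳ (sumℤ p (λ j → M i j * v j n)) ⟩
    0ℤ ∎
    where
    shifted : ℕ → ℤ
    shifted j = if i ℕ.≡ᵇ j then v j (suc n) else 0ℤ
    off-diagonal : ∀ j → j < p → j ≢ i → shifted j ≡ 0ℤ
    off-diagonal j _ ne = cong (λ b → if b then v j (suc n) else 0ℤ) (≡ᵇ-≢ i j (λ e → ne (sym e)))
    on-diagonal : shifted i ≡ sumℤ p (λ j → M i j * v j n)
    on-diagonal = trans (cong (λ b → if b then v i (suc n) else 0ℤ) (≡ᵇ-refl i)) (hv i ilt n)

  -- Cramer's rule over the ring of shift operators: pairing the cofactors of column c with the
  -- rows of (S − M) v = 0 leaves ± det (S − M) acting on v c.
  charPoly-annihilates : ∀ p M v → Solves p M v → ∀ c → c < p → ∀ k → act (det p (charMat M)) (v c) k ≡ 0ℤ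
  charPoly-annihilates (suc m) M v hv c clt k = act-negate^ c _ (v c) k (trans (sym cofactorSum≡±det) cofactorSum≡0)
    where
    p = suc m
    B : Mat
    B = charMat M
    cofactor : ℕ → Poly
    cofactor i = det m (minor i c B)
    cofactorSum : ℤ
    cofactorSum = sumℤ p (λ j → act (altΣ p (λ i → B i j ⊛ cofactor i)) (v j) k)
    cofactorSum≡±det : cofactorSum ≡ act (negate^ c (det p B)) (v c) k
    cofactorSum≡±det = trans (sumℤ-single p c _ clt (λ j jlt ne → PolyDet.expandColumn-foreign m c j B clt jlt ne (v j) k))
                             (PolyDet.det-expandColumn m c B clt (v c) k)
    cofactorSum≡0 : cofactorSum ≡ 0ℤ
    cofactorSum≡0 =
      trans (sumℤ-cong p (λ j _ → trans (act-altΣ p (λ i → B i j ⊛ cofactor i) (v j) k)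
               (IntDet.altΣ-cong p (λ i _ → trans (act-⊛ (B i j) (cofactor i) (v j) k) (act-comm (B i j) (cofactor i) (v j) k)))))
       (trans (sumℤ-altΣ p p (λ j i → act (cofactor i) (act (B i j) (v j)) k))
        (IntDet.altΣ-0 p _ (λ i ilt →
           trans (sym (act-sum (cofactor i) p (λ j → act (B i j) (v j)) k))
            (trans (act-cong (cofactor i) (charMat-row-annihilates p M v hv i ilt) k) (act-zeroSeq (cofactor i) k)))))

  linearSystem⇒recurrence : ∀ p M v → Solves p M v →
    Σ (ℕ → ℤ) λ a → ∀ c → c < p → ∀ k → v c (k ℕ.+ p) ≡ sumℤ p (λ m → a m * v c (k ℕ.+ m))
  linearSystem⇒recurrence p M v hv = (λ m → - coeff m χ) , recurrence
    where
    χ = det p (charMat M)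
    recurrence : ∀ c → c < p → ∀ k → v c (k ℕ.+ p) ≡ sumℤ p (λ m → (- coeff m χ) * v c (k ℕ.+ m))
    recurrence c clt k = begin
      v c (k ℕ.+ p)                               ≡⟨ inverseʳ-unique (sumℤ p lower) _ lower+top≡0 ⟩
      - sumℤ p lower                              ≡⟨ sym (sumℤ-neg p lower) ⟩
      sumℤ p (λ m → - lower m)                    ≡⟨ sumℤ-cong p (λ m _ → ℤP.neg-distribˡ-* (coeff m χ) _) ⟩
      sumℤ p (λ m → (- coeff m χ) * v c (k ℕ.+ m)) ∎
      where
      lower : ℕ → ℤ
      lower m = coeff m χ * v c (k ℕ.+ m)
      lower+top≡0 : sumℤ p lower + v c (k ℕ.+ p) ≡ 0ℤ
      lower+top≡0 = begin
        sumℤ p lower + v c (k ℕ.+ p)               ≡⟨ cong (_+_ (sumℤ p lower)) (sym (trans (cong (_* _) (charPoly-monic p M)) (ℤP.*-identityˡ _))) ⟩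
        sumℤ p lower + lower p                     ≡⟨ sym (sumℤ-last p lower) ⟩
        sumℤ (suc p) lower                         ≡⟨ sym (act-byCoefficients p χ (v c) k (DegreeLE-det p (charMat M) (DegreeLE-charMat M))) ⟩
        act χ (v c) k                              ≡⟨ charPoly-annihilates p M v hv c clt k ⟩
        0ℤ ∎

module ListSum where

  open import Defs
  open NatRangeSum
  open import Data.Nat using (ℕ; zero; suc; _+_; _*_; _<_; _≤_; z≤n; s≤s; _≡ᵇ_; _<ᵇ_)
  import Data.Nat.Properties as ℕP
  open import Data.Bool using (Bool; true; false; T; _∧_)
  open import Data.Unit using (tt)
  open import Data.List using (List; []; _∷_; _++_; map; concatMap; length; filter; upTo; applyUpTo)
  open import Data.Nat.ListAction using (sum)
  open import Data.Nat.ListAction.Properties using (sum-++)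
  open import Data.List.Relation.Unary.All as All using (All; []; _∷_)
  open import Relation.Binary.PropositionalEquality
  open import Relation.Nullary using (Dec; does)
  open import Data.Product using (Σ; _,_; _×_)
  open import Data.Empty using (⊥-elim)
  open import Data.List.Properties using (map-++)

  ΣL : ∀ {A : Set} → List A → (A → ℕ) → ℕ
  ΣL L f = sum (map f L)

  ΣL-++ : ∀ {A : Set} (L K : List A) f → ΣL (L ++ K) f ≡ ΣL L f + ΣL K f
  ΣL-++ L K f rewrite map-++ f L K = sum-++ (map f L) (map f K)

  ΣL-concatMap : ∀ {A B : Set} (g : A → List B) L f → ΣL (concatMap g L) f ≡ ΣL L (λ x → ΣL (g x) f)
  ΣL-concatMap g [] f = refl
  ΣL-concatMap g (x ∷ L) f = trans (ΣL-++ (g x) (concatMap g L) f) (cong (ΣL (g x) f +_) (ΣL-concatMap g L f))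

  ΣL-map : ∀ {A B : Set} (h : A → B) L f → ΣL (map h L) f ≡ ΣL L (λ x → f (h x))
  ΣL-map h [] f = refl
  ΣL-map h (x ∷ L) f = cong (f (h x) +_) (ΣL-map h L f)

  ΣL-applyUpTo : ∀ (h : ℕ → ℕ) n f → ΣL (applyUpTo h n) f ≡ sumℕ n (λ j → f (h j))
  ΣL-applyUpTo h zero f = refl
  ΣL-applyUpTo h (suc n) f = cong (f (h 0) +_) (ΣL-applyUpTo (λ j → h (suc j)) n f)

  ΣL-upTo : ∀ n f → ΣL (upTo n) f ≡ sumℕ n f
  ΣL-upTo n f = ΣL-applyUpTo (λ j → j) n f

  ΣL-cong : ∀ {A : Set} (L : List A) {f g} → (∀ x → f x ≡ g x) → ΣL L f ≡ ΣL L g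
  ΣL-cong [] e = refl
  ΣL-cong (x ∷ L) e = cong₂ _+_ (e x) (ΣL-cong L e)

  ΣL-*r : ∀ {A : Set} (L : List A) f c → ΣL L (λ x → f x * c) ≡ ΣL L f * c
  ΣL-*r [] f c = refl
  ΣL-*r (x ∷ L) f c = trans (cong (f x * c +_) (ΣL-*r L f c)) (sym (ℕP.*-distribʳ-+ c (f x) _))

  ΣL-filter : ∀ {A : Set} {P : A → Set} (P? : ∀ x → Dec (P x)) L f →
    ΣL (filter P? L) f ≡ ΣL L (λ x → bit (does (P? x)) * f x)
  ΣL-filter P? [] f = refl
  ΣL-filter P? (x ∷ L) f with does (P? x)
  ... | true = cong₂ _+_ (sym (ℕP.+-identityʳ (f x))) (ΣL-filter P? L f)
  ... | false = ΣL-filter P? L f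

  All-≤-sum : ∀ a → All (λ x → x ≤ sum a) a
  All-≤-sum [] = []
  All-≤-sum (x ∷ a) = ℕP.m≤m+n x (sum a) ∷ All.map (λ {y} le → ℕP.≤-trans le (ℕP.m≤n+m (sum a) x)) (All-≤-sum a)

  length≤sum : ∀ a → All (λ x → 1 ≤ x) a → length a ≤ sum a
  length≤sum [] _ = z≤n
  length≤sum (x ∷ a) (h ∷ hs) = ℕP.+-mono-≤ h (length≤sum a hs)

  ΣL-listsOver : ∀ L vs (f : List ℕ → ℕ) → ΣL (listsOver (suc L) vs) f ≡ ΣL vs (λ x → ΣL (listsOver L vs) (λ r → f (x ∷ r)))
  ΣL-listsOver L vs f =
    trans (ΣL-concatMap (λ x → map (x ∷_) (listsOver L vs)) vs f)
          (ΣL-cong vs (λ x → ΣL-map (x ∷_) (listsOver L vs) f))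

  nth : List (List ℕ) → ℕ → List ℕ
  nth [] j = []
  nth (x ∷ L) zero = x
  nth (x ∷ L) (suc j) = nth L j

  ΣL-nth : ∀ L f → ΣL L f ≡ sumℕ (length L) (λ j → f (nth L j))
  ΣL-nth [] f = refl
  ΣL-nth (x ∷ L) f = cong (f x +_) (ΣL-nth L f)

  All-nth : ∀ {Q : List ℕ → Set} L → All Q L → ∀ i → i < length L → Q (nth L i)
  All-nth (x ∷ L) (q ∷ qs) zero _ = q
  All-nth (x ∷ L) (q ∷ qs) (suc i) (s≤s lt) = All-nth L qs i lt

  sameList : List ℕ → List ℕ → Bool
  sameList [] [] = true
  sameList [] (_ ∷ _) = false
  sameList (_ ∷ _) [] = false
  sameList (x ∷ xs) (y ∷ ys) = (x ≡ᵇ y) ∧ sameList xs ys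

  sameList-sound : ∀ a b → T (sameList a b) → a ≡ b
  sameList-sound [] [] _ = refl
  sameList-sound (x ∷ xs) (y ∷ ys) q with x ≡ᵇ y in e
  ... | true = cong₂ _∷_ (ℕP.≡ᵇ⇒≡ x y (subst T (sym e) tt)) (sameList-sound xs ys q)

  sameList-refl : ∀ a → sameList a a ≡ true
  sameList-refl [] = refl
  sameList-refl (x ∷ xs) rewrite sameList-refl xs with x ≡ᵇ x in e
  ... | true = refl
  ... | false = ⊥-elim (subst T e (ℕP.≡⇒≡ᵇ x x refl))

  count-upTo : ∀ n x → sumℕ n (λ y → bit (x ≡ᵇ y)) ≡ bit (x <ᵇ n)
  count-upTo zero x = refl
  count-upTo (suc n) zero = cong suc (sumℕ-0 n (λ y → bit (0 ≡ᵇ suc y)) (λ _ _ → refl))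
  count-upTo (suc n) (suc x) = count-upTo n x

  count-listsOver : ∀ (vs : List ℕ) L a → All (λ x → ΣL vs (λ y → bit (x ≡ᵇ y)) ≡ 1) a →
    ΣL (listsOver L vs) (λ r → bit (sameList a r)) ≡ bit (length a ≡ᵇ L)
  count-listsOver vs zero [] _ = refl
  count-listsOver vs zero (x ∷ a) _ = refl
  count-listsOver vs (suc L) a h =
    trans (ΣL-listsOver L vs (λ r → bit (sameList a r))) (by-first-entry a h)
    where
    by-first-entry : ∀ a → All (λ x → ΣL vs (λ y → bit (x ≡ᵇ y)) ≡ 1) a →
         ΣL vs (λ y → ΣL (listsOver L vs) (λ r → bit (sameList a (y ∷ r)))) ≡ bit (length a ≡ᵇ suc L)
    by-first-entry [] _ = trans (ΣL-cong vs {g = λ _ → 0} (λ y → ΣL-0 (listsOver L vs))) (ΣL-0 vs)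
      where
      ΣL-0 : ∀ {A : Set} (K : List A) → ΣL K (λ _ → 0) ≡ 0
      ΣL-0 [] = refl
      ΣL-0 (_ ∷ K) = ΣL-0 K
    by-first-entry (x ∷ a) (hx ∷ ha) =
      trans (ΣL-cong vs (λ y → trans (ΣL-cong (listsOver L vs) (λ r → bit-∧ (x ≡ᵇ y) (sameList a r)))
               (trans (ΣL-cong (listsOver L vs) (λ r → ℕP.*-comm (bit (x ≡ᵇ y)) (bit (sameList a r))))
                 (ΣL-*r (listsOver L vs) (λ r → bit (sameList a r)) (bit (x ≡ᵇ y))))))
       (trans (ΣL-cong vs (λ y → cong (_* bit (x ≡ᵇ y)) (count-listsOver vs L a ha)))
        (trans (ΣL-cong vs (λ y → ℕP.*-comm (bit (length a ≡ᵇ L)) (bit (x ≡ᵇ y))))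
         (trans (ΣL-*r vs (λ y → bit (x ≡ᵇ y)) (bit (length a ≡ᵇ L)))
           (trans (cong (_* bit (length a ≡ᵇ L)) hx) (ℕP.*-identityˡ _)))))

  bit≡1 : ∀ b → T b → bit b ≡ 1
  bit≡1 true _ = refl

  sum-bits≡1⇒∃ : ∀ n (b : ℕ → Bool) → sumℕ n (λ j → bit (b j)) ≡ 1 → Σ ℕ λ j → j < n × T (b j)
  sum-bits≡1⇒∃ zero b ()
  sum-bits≡1⇒∃ (suc n) b e with b 0 in eq
  ... | true = 0 , s≤s z≤n , subst T (sym eq) tt
  ... | false with sum-bits≡1⇒∃ n (λ j → b (suc j)) e
  ...   | j , lt , q = suc j , s≤s lt , q

  ΣL-*l : ∀ {A : Set} (L : List A) c f → ΣL L (λ x → c * f x) ≡ c * ΣL L f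
  ΣL-*l L c f = trans (ΣL-cong L (λ x → ℕP.*-comm c (f x))) (trans (ΣL-*r L f c) (ℕP.*-comm _ c))

  length-sum : ∀ {A : Set} (L : List A) → length L ≡ ΣL L (λ _ → 1)
  length-sum [] = refl
  length-sum (x ∷ L) = cong suc (length-sum L)

module BoolTests where

  open import Data.Nat using (ℕ; zero; suc; _+_; _∸_; _<_; _≤_; z≤n; s≤s; _≤ᵇ_; _≡ᵇ_)
  import Data.Nat.Properties as ℕP
  open import Data.Bool using (Bool; true; false; T; _∧_)
  open import Data.Bool.Properties using (∧-zeroʳ)
  open import Data.Unit using (tt)
  open import Data.List using (List; []; _∷_; upTo; applyUpTo)
  open import Data.List.Relation.Unary.All as All using (All; []; _∷_)
  open import Relation.Binary.PropositionalEquality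
  open import Relation.Nullary using (Dec; does)
  open import Data.Empty using (⊥-elim)

  allB : ∀ {A : Set} → (A → Bool) → List A → Bool
  allB p [] = true
  allB p (x ∷ xs) = p x ∧ allB p xs

  T-ext : ∀ a b → (T a → T b) → (T b → T a) → a ≡ b
  T-ext true true f g = refl
  T-ext true false f g = ⊥-elim (f tt)
  T-ext false true f g = ⊥-elim (g tt)
  T-ext false false f g = refl

  T∧ : ∀ {a b} → T a → T b → T (a ∧ b)
  T∧ {true} {true} _ _ = tt

  T∧₁ : ∀ {a b} → T (a ∧ b) → T a
  T∧₁ {true} _ = tt

  T∧₂ : ∀ {a b} → T (a ∧ b) → T b
  T∧₂ {true} q = q

  allB-∧ : ∀ {A : Set} (p q : A → Bool) xs → allB (λ x → p x ∧ q x) xs ≡ allB p xs ∧ allB q xs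
  allB-∧ p q [] = refl
  allB-∧ p q (x ∷ xs) rewrite allB-∧ p q xs with p x | q x
  ... | true | true = refl
  ... | true | false = sym (∧-zeroʳ (allB p xs))
  ... | false | _ = refl

  allB-applyUpTo-cong : ∀ (p q : ℕ → Bool) (h : ℕ → ℕ) n → (∀ j → j < n → p (h j) ≡ q (h j)) →
    allB p (applyUpTo h n) ≡ allB q (applyUpTo h n)
  allB-applyUpTo-cong p q h zero e = refl
  allB-applyUpTo-cong p q h (suc n) e =
    cong₂ _∧_ (e 0 (s≤s z≤n)) (allB-applyUpTo-cong p q (λ j → h (suc j)) n (λ j lt → e (suc j) (s≤s lt)))

  allB-upTo-cong : ∀ (p q : ℕ → Bool) n → (∀ j → j < n → p j ≡ q j) → allB p (upTo n) ≡ allB q (upTo n)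
  allB-upTo-cong p q n e = allB-applyUpTo-cong p q (λ j → j) n e

  T-allB-applyUpTo : ∀ (p : ℕ → Bool) (h : ℕ → ℕ) n → T (allB p (applyUpTo h n)) → ∀ j → j < n → T (p (h j))
  T-allB-applyUpTo p h (suc n) q zero _ = T∧₁ q
  T-allB-applyUpTo p h (suc n) q (suc j) (s≤s lt) = T-allB-applyUpTo p (λ j → h (suc j)) n (T∧₂ {p (h 0)} q) j lt

  allB-applyUpTo-T : ∀ (p : ℕ → Bool) (h : ℕ → ℕ) n → (∀ j → j < n → T (p (h j))) → T (allB p (applyUpTo h n))
  allB-applyUpTo-T p h zero f = tt
  allB-applyUpTo-T p h (suc n) f = T∧ (f 0 (s≤s z≤n)) (allB-applyUpTo-T p (λ j → h (suc j)) n (λ j lt → f (suc j) (s≤s lt)))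

  T-allB-upTo : ∀ (p : ℕ → Bool) n → T (allB p (upTo n)) → ∀ j → j < n → T (p j)
  T-allB-upTo p n = T-allB-applyUpTo p (λ j → j) n

  allB-upTo-T : ∀ (p : ℕ → Bool) n → (∀ j → j < n → T (p j)) → T (allB p (upTo n))
  allB-upTo-T p n = allB-applyUpTo-T p (λ j → j) n

  does-all? : ∀ {A : Set} {P : A → Set} (P? : ∀ x → Dec (P x)) xs →
    does (All.all? P? xs) ≡ allB (λ x → does (P? x)) xs
  does-all? P? [] = refl
  does-all? P? (x ∷ xs) = cong (does (P? x) ∧_) (does-all? P? xs)

  ≡ᵇ-T : ∀ {m n} → m ≡ n → T (m ≡ᵇ n)
  ≡ᵇ-T {m} {n} e = ℕP.≡⇒≡ᵇ m n e

  T-≡ᵇ : ∀ {m n} → T (m ≡ᵇ n) → m ≡ n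
  T-≡ᵇ {m} {n} q = ℕP.≡ᵇ⇒≡ m n q

  ≤ᵇ-T : ∀ {m n} → m ≤ n → T (m ≤ᵇ n)
  ≤ᵇ-T le = ℕP.≤⇒≤ᵇ le

  T-≤ᵇ : ∀ {m n} → T (m ≤ᵇ n) → m ≤ n
  T-≤ᵇ {m} {n} q = ℕP.≤ᵇ⇒≤ m n q

  +≡ᵇ-split : ∀ e X C → (e + X ≡ᵇ C) ≡ (e ≤ᵇ C) ∧ (X ≡ᵇ C ∸ e)
  +≡ᵇ-split e X C = T-ext _ _
    (λ q → let eq = T-≡ᵇ q in T∧ (≤ᵇ-T (subst (e ≤_) eq (ℕP.m≤m+n e X)))
                                  (≡ᵇ-T (sym (trans (cong (_∸ e) (sym eq)) (ℕP.m+n∸m≡n e X)))))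
    (λ q → ≡ᵇ-T (trans (cong (e +_) (T-≡ᵇ (T∧₂ {e ≤ᵇ C} q))) (ℕP.m+[n∸m]≡n (T-≤ᵇ {e} {C} (T∧₁ {e ≤ᵇ C} {X ≡ᵇ C ∸ e} q)))))

  ∧-rearr : ∀ a R f C → (a ∧ R) ∧ (f ∧ C) ≡ (a ∧ f) ∧ (R ∧ C)
  ∧-rearr true R true C = refl
  ∧-rearr true R false C = ∧-zeroʳ R
  ∧-rearr false R f C = refl

module ColumnEntries where

  open import Defs
  open import Data.Nat using (ℕ; zero; suc; _+_; _∸_; _<_; _≤_; z≤n; s≤s)
  import Data.Nat.Properties as ℕP
  open import Data.List using (List; []; _∷_; [_]; _++_; map; length; applyUpTo; replicate)
  open import Data.Nat.ListAction using (sum)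
  open import Data.Nat.ListAction.Properties using (sum-++)
  open import Data.List.Relation.Unary.All using (All; []; _∷_)
  open import Relation.Binary.PropositionalEquality hiding ([_])

  -- The j-th entry of a list, or 0 past its end.
  entry : ℕ → List ℕ → ℕ
  entry j l = sum (entryAt j l)

  entry-0 : ∀ x xs → entry 0 (x ∷ xs) ≡ x
  entry-0 x xs = ℕP.+-identityʳ x

  sum-column-∷ : ∀ j r A → sum (column j (r ∷ A)) ≡ entry j r + sum (column j A)
  sum-column-∷ j r A = sum-++ (entryAt j r) (column j A)

  _⊖_ : List ℕ → List ℕ → List ℕ
  [] ⊖ r = []
  (c ∷ cs) ⊖ [] = c ∷ cs
  (c ∷ cs) ⊖ (x ∷ r) = (c ∸ x) ∷ (cs ⊖ r)

  entry-⊖ : ∀ j c r → entry j (c ⊖ r) ≡ entry j c ∸ entry j r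
  entry-⊖ j [] r = sym (ℕP.0∸n≡0 (entry j r))
  entry-⊖ j (c ∷ cs) [] = refl
  entry-⊖ zero (c ∷ cs) (x ∷ r) = trans (entry-0 (c ∸ x) (cs ⊖ r)) (sym (cong₂ _∸_ (entry-0 c cs) (entry-0 x r)))
  entry-⊖ (suc j) (c ∷ cs) (x ∷ r) = entry-⊖ j cs r

  entry-ext : ∀ a b → length a ≡ length b → (∀ j → j < length a → entry j a ≡ entry j b) → a ≡ b
  entry-ext [] [] _ _ = refl
  entry-ext (x ∷ a) (y ∷ b) el h =
    cong₂ _∷_ (trans (sym (entry-0 x a)) (trans (h 0 (s≤s z≤n)) (entry-0 y b)))
              (entry-ext a b (ℕP.suc-injective el) (λ j lt → h (suc j) (s≤s lt)))

  entry-++ˡ : ∀ j ds e → j < length ds → entry j (ds ++ e) ≡ entry j ds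
  entry-++ˡ zero (d ∷ ds) e _ = trans (entry-0 d (ds ++ e)) (sym (entry-0 d ds))
  entry-++ˡ (suc j) (d ∷ ds) e (s≤s lt) = entry-++ˡ j ds e lt

  entry-++ʳ : ∀ j ds e → entry (length ds + j) (ds ++ e) ≡ entry j e
  entry-++ʳ j [] e = refl
  entry-++ʳ j (d ∷ ds) e = entry-++ʳ j ds e

  entry-replicate : ∀ j k x → j < k → entry j (replicate k x) ≡ x
  entry-replicate zero (suc k) x _ = entry-0 x (replicate k x)
  entry-replicate (suc j) (suc k) x (s≤s lt) = entry-replicate j k x lt

  entry-≤ : ∀ j r c → All (λ x → x ≤ c) r → entry j r ≤ c
  entry-≤ j [] c _ = z≤n
  entry-≤ zero (x ∷ r) c (h ∷ _) = subst (_≤ c) (sym (entry-0 x r)) h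
  entry-≤ (suc j) (x ∷ r) c (_ ∷ hs) = entry-≤ j r c hs

  ⊖[] : ∀ c → c ⊖ [] ≡ c
  ⊖[] [] = refl
  ⊖[] (x ∷ c) = refl

  rowLengthsFrom : ℕ → ℕ → List ℕ
  rowLengthsFrom L zero = L ∷ []
  rowLengthsFrom L (suc k) = suc L ∷ rowLengthsFrom (suc L) k

  rowLengths≡rowLengthsFrom : ∀ a k → map (λ i → i + 2) (applyUpTo (a +_) k) ++ [ suc (a + k) ] ≡ rowLengthsFrom (suc a) k
  rowLengths≡rowLengthsFrom a zero = cong (λ x → [ suc x ]) (ℕP.+-identityʳ a)
  rowLengths≡rowLengthsFrom a (suc k) =
    cong₂ _∷_ (trans (cong (_+ 2) (ℕP.+-identityʳ a)) (ℕP.+-comm a 2))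
      (trans (cong₂ (λ u v → map (λ i → i + 2) u ++ [ suc v ])
                (applyUpTo-cong k (λ j → ℕP.+-suc a j)) (ℕP.+-suc a k))
             (rowLengths≡rowLengthsFrom (suc a) k))
    where
    applyUpTo-cong : ∀ {f g : ℕ → ℕ} n → (∀ j → f j ≡ g j) → applyUpTo f n ≡ applyUpTo g n
    applyUpTo-cong zero e = refl
    applyUpTo-cong (suc n) e = cong₂ _∷_ (e 0) (applyUpTo-cong n (λ j → e (suc j)))

module DropZeros where

  open import Data.Nat using (ℕ; zero; suc; _+_; _≤_; z≤n; s≤s)
  open import Data.List using (List; []; _∷_)
  open import Data.Nat.ListAction using (sum)
  open import Data.List.Relation.Unary.All using (All; []; _∷_)
  open import Relation.Binary.PropositionalEquality

  dropZeros : List ℕ → List ℕ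
  dropZeros [] = []
  dropZeros (zero ∷ xs) = dropZeros xs
  dropZeros (suc x ∷ xs) = suc x ∷ dropZeros xs

  dropZeros-idem : ∀ xs → dropZeros (dropZeros xs) ≡ dropZeros xs
  dropZeros-idem [] = refl
  dropZeros-idem (zero ∷ xs) = dropZeros-idem xs
  dropZeros-idem (suc x ∷ xs) = cong (suc x ∷_) (dropZeros-idem xs)

  dropZeros-∷ : ∀ c zs → dropZeros (c ∷ dropZeros zs) ≡ dropZeros (c ∷ zs)
  dropZeros-∷ zero zs = dropZeros-idem zs
  dropZeros-∷ (suc c) zs = cong (suc c ∷_) (dropZeros-idem zs)

  dropZeros-sum : ∀ zs → sum (dropZeros zs) ≡ sum zs
  dropZeros-sum [] = refl
  dropZeros-sum (zero ∷ zs) = dropZeros-sum zs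
  dropZeros-sum (suc x ∷ zs) = cong (suc x +_) (dropZeros-sum zs)

  dropZeros-positive : ∀ zs → All (λ x → 1 ≤ x) (dropZeros zs)
  dropZeros-positive [] = []
  dropZeros-positive (zero ∷ zs) = dropZeros-positive zs
  dropZeros-positive (suc x ∷ zs) = s≤s z≤n ∷ dropZeros-positive zs

module Transfer (t : ℕ) where

  open NatRangeSum
  open DropZeros
  open import Data.Nat using (ℕ; zero; suc; _+_; _*_; _∸_; _≤_; _≤ᵇ_; _≡ᵇ_)
  import Data.Nat.Properties as ℕP
  open import Data.List using (List; []; _∷_)
  open import Data.Nat.ListAction using (sum)
  open import Relation.Binary.PropositionalEquality
  open import Data.List.Relation.Binary.Permutation.Propositional as Perm using (_↭_)
  open import Data.Nat.Tactic.RingSolver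

  -- A state lists the column deficits (t minus the partial column sums) of the open columns.
  -- step ds s g sums g over the states reached by one more row: it takes x ≤ d from each open
  -- column, where s is the partial row sum, and then y from a newly opened column so that the row
  -- sums to t; the new column is left with deficit t ∸ y.
  step : List ℕ → ℕ → (List ℕ → ℕ) → ℕ
  step [] s g = sumℕ (suc t) (λ y → bit (s + y ≡ᵇ t) * g (t ∸ y ∷ []))
  step (d ∷ ds) s g = sumℕ (suc t) (λ x → bit (x ≤ᵇ d) * step ds (s + x) (λ zs → g (d ∸ x ∷ zs)))

  -- Fillings of k further rows, each one longer than the last, followed by the final row,
  -- which is forced to equal the remaining deficits.
  completions : List ℕ → ℕ → ℕ
  completions ds zero = 1
  completions ds (suc k) = step ds 0 (λ zs → completions zs k)

  step-cong-onSum : ∀ ds s g g' → (∀ zs → sum zs ≡ sum ds + s → g zs ≡ g' zs) → step ds s g ≡ step ds s g'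
  step-cong-onSum [] s g g' e = sumℕ-cong (suc t) (λ y _ → bit-*-cong (s + y ≡ᵇ t) (g (t ∸ y ∷ [])) (g' (t ∸ y ∷ [])) (λ q →
     e (t ∸ y ∷ []) (trans (ℕP.+-identityʳ _) (trans (cong (_∸ y) (sym (ℕP.≡ᵇ⇒≡ _ _ q))) (ℕP.m+n∸n≡m s y)))))
  step-cong-onSum (d ∷ ds) s g g' e = sumℕ-cong (suc t) (λ x _ → bit-*-cong (x ≤ᵇ d)
     (step ds (s + x) (λ zs → g (d ∸ x ∷ zs))) (step ds (s + x) (λ zs → g' (d ∸ x ∷ zs))) (λ q →
     step-cong-onSum ds (s + x) (λ zs → g (d ∸ x ∷ zs)) (λ zs → g' (d ∸ x ∷ zs)) (λ zs ez → e (d ∸ x ∷ zs) (deficit-sum {x} {zs} (ℕP.≤ᵇ⇒≤ x d q) ez))))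
    where
    deficit-sum : ∀ {x zs} → x ≤ d → sum zs ≡ sum ds + (s + x) → (d ∸ x) + sum zs ≡ (d + sum ds) + s
    deficit-sum {x} {zs} le ez rewrite ez = trans (rearrange (d ∸ x) (sum ds) s x) (cong (λ u → u + sum ds + s) (ℕP.m∸n+n≡m le))
      where
      rearrange : ∀ a S s x → a + (S + (s + x)) ≡ (a + x) + S + s
      rearrange = solve-∀

  step-cong : ∀ ds s g g' → (∀ zs → g zs ≡ g' zs) → step ds s g ≡ step ds s g'
  step-cong ds s g g' e = step-cong-onSum ds s g g' (λ zs _ → e zs)

  ZeroInvariant : (List ℕ → ℕ) → Set
  ZeroInvariant g = ∀ zs → g zs ≡ g (dropZeros zs)

  ZeroInvariant-∷ : ∀ g c → ZeroInvariant g → ZeroInvariant (λ zs → g (c ∷ zs))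
  ZeroInvariant-∷ g c z zs = trans (z (c ∷ zs)) (trans (cong g (sym (dropZeros-∷ c zs))) (sym (z (c ∷ dropZeros zs))))

  step-dropZeros : ∀ ds s g → ZeroInvariant g → step ds s g ≡ step (dropZeros ds) s g
  step-dropZeros [] s g z = refl
  step-dropZeros (zero ∷ ds) s g z =
    trans (cong₂ _+_ refl (sumℕ-0 t (λ j → bit (suc j ≤ᵇ 0) * step ds (s + suc j) (λ zs → g (0 ∸ suc j ∷ zs))) (λ _ _ → refl)))
     (trans (ℕP.+-identityʳ _)
      (trans (ℕP.+-identityʳ _)
       (trans (cong (λ u → step ds u (λ zs → g (0 ∷ zs))) (ℕP.+-identityʳ s))
        (trans (step-cong ds s _ g (λ zs → trans (z (0 ∷ zs)) (sym (z zs))))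
         (step-dropZeros ds s g z)))))
  step-dropZeros (suc d ∷ ds) s g z = sumℕ-cong (suc t) (λ x _ →
     cong (bit (x ≤ᵇ suc d) *_) (step-dropZeros ds (s + x) _ (ZeroInvariant-∷ g (suc d ∸ x) z)))

  completions-dropZeros : ∀ k ds → completions ds k ≡ completions (dropZeros ds) k
  completions-dropZeros zero ds = refl
  completions-dropZeros (suc k) ds = step-dropZeros ds 0 (λ zs → completions zs k) (λ zs → completions-dropZeros k zs)

  PermInvariant : (List ℕ → ℕ) → Set
  PermInvariant g = ∀ {xs ys} → xs ↭ ys → g xs ≡ g ys

  PermInvariant-∷ : ∀ g c → PermInvariant g → PermInvariant (λ zs → g (c ∷ zs))
  PermInvariant-∷ g c p q = p (Perm.prep c q)

  step-↭ : ∀ {ds es} → ds ↭ es → ∀ s g → PermInvariant g → step ds s g ≡ step es s g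
  step-↭ Perm.refl s g p = refl
  step-↭ (Perm.prep d q) s g p = sumℕ-cong (suc t) (λ x _ →
     cong (bit (x ≤ᵇ d) *_) (step-↭ q (s + x) _ (PermInvariant-∷ g (d ∸ x) p)))
  step-↭ {d ∷ e ∷ ds} {.e ∷ .d ∷ es} (Perm.swap .d .e q) s g p =
    trans (sumℕ-cong (suc t) (λ x _ → cong (bit (x ≤ᵇ d) *_) (sumℕ-cong (suc t) (λ y _ →
              cong (bit (y ≤ᵇ e) *_) (inner x y)))))
          (sumℕ-*-interchange (suc t) (suc t) (λ x → bit (x ≤ᵇ d)) (λ y → bit (y ≤ᵇ e))
             (λ x y → step es (s + y + x) (λ zs → g (e ∸ y ∷ d ∸ x ∷ zs))))
    where
    inner : ∀ x y → step ds (s + x + y) (λ zs → g (d ∸ x ∷ e ∸ y ∷ zs)) ≡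
                    step es (s + y + x) (λ zs → g (e ∸ y ∷ d ∸ x ∷ zs))
    inner x y = trans (step-↭ q (s + x + y) _ (PermInvariant-∷ _ (e ∸ y) (PermInvariant-∷ g (d ∸ x) p)))
      (trans (cong (λ u → step es u (λ zs → g (d ∸ x ∷ e ∸ y ∷ zs)))
                (trans (ℕP.+-assoc s x y) (trans (cong (s +_) (ℕP.+-comm x y)) (sym (ℕP.+-assoc s y x)))))
        (step-cong es (s + y + x) _ _ (λ zs → p (Perm.swap (d ∸ x) (e ∸ y) Perm.refl))))
  step-↭ (Perm.trans q₁ q₂) s g p = trans (step-↭ q₁ s g p) (step-↭ q₂ s g p)

  completions-↭ : ∀ k → PermInvariant (λ zs → completions zs k)
  completions-↭ zero q = refl
  completions-↭ (suc k) q = step-↭ q 0 (λ zs → completions zs k) (completions-↭ k)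

  step-sum : ∀ ds s (f : List ℕ → ℕ → ℕ) n →
    step ds s (λ zs → sumℕ n (f zs)) ≡ sumℕ n (λ j → step ds s (λ zs → f zs j))
  step-sum [] s f n =
    trans (sumℕ-cong (suc t) (λ y _ → sym (sumℕ-*l n (bit (s + y ≡ᵇ t)) (f (t ∸ y ∷ [])))))
          (sumℕ-swap (suc t) n (λ y j → bit (s + y ≡ᵇ t) * f (t ∸ y ∷ []) j))
  step-sum (d ∷ ds) s f n =
    trans (sumℕ-cong (suc t) (λ x _ → trans (cong (bit (x ≤ᵇ d) *_) (step-sum ds (s + x) (λ zs → f (d ∸ x ∷ zs)) n))
             (sym (sumℕ-*l n (bit (x ≤ᵇ d)) (λ j → step ds (s + x) (λ zs → f (d ∸ x ∷ zs) j))))))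
          (sumℕ-swap (suc t) n (λ x j → bit (x ≤ᵇ d) * step ds (s + x) (λ zs → f (d ∸ x ∷ zs) j)))

  step-*r : ∀ ds s g c → step ds s (λ zs → g zs * c) ≡ step ds s g * c
  step-*r [] s g c =
    trans (sumℕ-cong (suc t) (λ y _ → sym (ℕP.*-assoc (bit (s + y ≡ᵇ t)) (g (t ∸ y ∷ [])) c)))
      (sumℕ-*r (suc t) (λ y → bit (s + y ≡ᵇ t) * g (t ∸ y ∷ [])) c)
  step-*r (d ∷ ds) s g c =
    trans (sumℕ-cong (suc t) (λ x _ → trans (cong (bit (x ≤ᵇ d) *_) (step-*r ds (s + x) (λ zs → g (d ∸ x ∷ zs)) c))
              (sym (ℕP.*-assoc (bit (x ≤ᵇ d)) (step ds (s + x) (λ zs → g (d ∸ x ∷ zs))) c))))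
          (sumℕ-*r (suc t) (λ x → bit (x ≤ᵇ d) * step ds (s + x) (λ zs → g (d ∸ x ∷ zs))) c)

module PartitionStates (t : ℕ) where

  open Transfer t public
  open import Defs
  open NatRangeSum
  open ListSum
  open DropZeros
  open import Data.Nat using (ℕ; zero; suc; _+_; _*_; _<_; _≤_; z≤n; s≤s; _≡ᵇ_)
  import Data.Nat.Properties as ℕP
  open import Data.Bool using (true; false; T)
  open import Data.Unit using (tt)
  open import Data.List using (List; []; _∷_; map; length; filter; upTo)
  open import Data.Nat.ListAction using (sum)
  open import Data.Nat.ListAction.Properties using (sum-↭)
  open import Data.List.Relation.Unary.All as All using (All; []; _∷_)
  open import Data.List.Relation.Unary.All.Properties using (all-filter)
  open import Data.List.Relation.Binary.Permutation.Propositional using (↭-sym)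
  open import Data.List.Relation.Binary.Permutation.Propositional.Properties using (All-resp-↭)
  open import Relation.Binary.PropositionalEquality
  open ≡-Reasoning
  open import Relation.Nullary using (does)
  open import Relation.Nullary.Decidable using (dec-true)
  open import Data.Product using (Σ; _,_; _×_; proj₁)
  import Relation.Binary.Properties.DecTotalOrder as DTOP
  open import Data.List.Sort (DTOP.≥-decTotalOrder ℕP.≤-decTotalOrder) using (sort; sort-↭; sort-↗)

  partitions : List (List ℕ)
  partitions = filter (isPartition? t) (partitionCandidates t)

  p : ℕ
  p = partitionCount t

  normalise : List ℕ → List ℕ
  normalise zs = sort (dropZeros zs)

  normalise-isPartition : ∀ zs → sum zs ≡ t → IsPartition t (normalise zs)
  normalise-isPartition zs e = trans (sum-↭ (sort-↭ (dropZeros zs))) (trans (dropZeros-sum zs) e)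
              , sort-↗ (dropZeros zs)
              , All-resp-↭ (↭-sym (sort-↭ (dropZeros zs))) (dropZeros-positive zs)

  completions-normalise : ∀ k zs → completions zs k ≡ completions (normalise zs) k
  completions-normalise k zs = trans (completions-dropZeros k zs) (completions-↭ k (↭-sym (sort-↭ (dropZeros zs))))

  count-candidates : ∀ a → IsPartition t a → ΣL (partitionCandidates t) (λ ρ → bit (sameList a ρ)) ≡ 1
  count-candidates a (es , _ , pos) =
    trans (ΣL-concatMap (λ k → listsOver k (map suc (upTo t))) (upTo (suc t)) (λ ρ → bit (sameList a ρ)))
     (trans (ΣL-cong (upTo (suc t)) (λ k → count-listsOver (map suc (upTo t)) k a entry))
      (trans (ΣL-upTo (suc t) (λ k → bit (length a ≡ᵇ k)))
       (trans (count-upTo (suc t) (length a))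
         (bit≡1 _ (ℕP.<⇒<ᵇ (s≤s (subst (length a ≤_) es (length≤sum a pos))))))))
    where
    entry : All (λ x → ΣL (map suc (upTo t)) (λ y → bit (x ≡ᵇ y)) ≡ 1) a
    entry = All.zipWith (λ { {zero} (() , _) ; {suc x} (s≤s z≤n , le) →
        trans (ΣL-map suc (upTo t) (λ y → bit (suc x ≡ᵇ y)))
         (trans (ΣL-upTo t (λ y → bit (x ≡ᵇ y)))
          (trans (count-upTo t x) (bit≡1 _ (ℕP.<⇒<ᵇ (subst (suc x ≤_) es le))))) })
      (pos , All-≤-sum a)

  sum-partitions-indicator : ∀ a → IsPartition t a → ∀ (h : List ℕ → ℕ) →
    sumℕ p (λ j → bit (sameList a (nth partitions j)) * h (nth partitions j)) ≡ h a
  sum-partitions-indicator a pa h =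
    trans (sym (ΣL-nth partitions (λ ρ → bit (sameList a ρ) * h ρ)))
     (trans (ΣL-filter (isPartition? t) (partitionCandidates t) (λ ρ → bit (sameList a ρ) * h ρ))
      (trans (ΣL-cong (partitionCandidates t) pointwise)
       (trans (ΣL-*r (partitionCandidates t) (λ ρ → bit (sameList a ρ)) (h a))
        (trans (cong (_* h a) (count-candidates a pa)) (ℕP.+-identityʳ (h a))))))
    where
    pointwise : ∀ ρ → bit (does (isPartition? t ρ)) * (bit (sameList a ρ) * h ρ) ≡ bit (sameList a ρ) * h a
    pointwise ρ with sameList a ρ in e
    ... | false = ℕP.*-zeroʳ (bit (does (isPartition? t ρ)))
    ... | true with sameList-sound a ρ (subst T (sym e) tt)
    ...   | refl rewrite dec-true (isPartition? t a) pa = ℕP.+-identityʳ _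

  partitions-valid : ∀ i → i < p → IsPartition t (nth partitions i)
  partitions-valid i lt = All-nth partitions (all-filter (isPartition? t) (partitionCandidates t)) i lt

  -- Entry (i, j) counts the rows leading from the state πᵢ to a state whose normal form is πⱼ.
  transferMatrix : ℕ → ℕ → ℕ
  transferMatrix i j = step (nth partitions i) 0 (λ zs → bit (sameList (normalise zs) (nth partitions j)))

  completions-suc : ∀ i → i < p → ∀ k →
    completions (nth partitions i) (suc k) ≡ sumℕ p (λ j → transferMatrix i j * completions (nth partitions j) k)
  completions-suc i lt k = begin
    completions π (suc k)
      ≡⟨ step-cong-onSum π 0 _ _ regroup ⟩
    step π 0 (λ zs → sumℕ p (λ j → indicator zs j * completions (nth partitions j) k))
      ≡⟨ step-sum π 0 (λ zs j → indicator zs j * completions (nth partitions j) k) p ⟩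
    sumℕ p (λ j → step π 0 (λ zs → indicator zs j * completions (nth partitions j) k))
      ≡⟨ sumℕ-cong p (λ j _ → step-*r π 0 (λ zs → indicator zs j) (completions (nth partitions j) k)) ⟩
    sumℕ p (λ j → transferMatrix i j * completions (nth partitions j) k) ∎
    where
    π = nth partitions i
    indicator : List ℕ → ℕ → ℕ
    indicator zs j = bit (sameList (normalise zs) (nth partitions j))
    regroup : ∀ zs → sum zs ≡ sum π + 0 →
      completions zs k ≡ sumℕ p (λ j → indicator zs j * completions (nth partitions j) k)
    regroup zs ez = trans (completions-normalise k zs)
      (sym (sum-partitions-indicator (normalise zs) (normalise-isPartition zs π-sum) (λ ρ → completions ρ k)))
      where
      π-sum : sum zs ≡ t
      π-sum = trans ez (trans (ℕP.+-identityʳ _) (proj₁ (partitions-valid i lt)))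

  initialState : Σ ℕ λ i → i < p × nth partitions i ≡ normalise (t ∷ [])
  initialState with sum-bits≡1⇒∃ p (λ j → sameList (normalise (t ∷ [])) (nth partitions j))
              (trans (sumℕ-cong p (λ j _ → sym (ℕP.*-identityʳ _)))
                 (sum-partitions-indicator (normalise (t ∷ [])) (normalise-isPartition (t ∷ []) (ℕP.+-identityʳ t)) (λ _ → 1)))
  ... | i , lt , q = i , lt , sym (sameList-sound _ _ q)

module ArrayCount (t : ℕ) where

  open Transfer t
  open import Defs
  open NatRangeSum
  open ListSum
  open BoolTests
  open ColumnEntries
  open import Data.Nat using (ℕ; zero; suc; _+_; _*_; _∸_; _<_; _≤_; z≤n; s≤s; _≤ᵇ_; _≡ᵇ_)
  import Data.Nat.Properties as ℕP
  open import Data.Bool using (Bool; true; false; T; _∧_)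
  open import Data.Unit using (tt)
  open import Data.List using (List; []; _∷_; _++_; map; length; filter; upTo; replicate)
  open import Data.Nat.ListAction using (sum)
  open import Data.List.Relation.Unary.All as All using (All; []; _∷_)
  open import Data.List.Properties using (++-identityʳ)
  open import Relation.Binary.PropositionalEquality
  open import Relation.Nullary using (does)
  open import Relation.Binary.Definitions using (tri<; tri≈; tri>)
  open import Data.Nat.Tactic.RingSolver

  entryValues : List ℕ
  entryValues = upTo (suc t)

  rowSumsᵇ : List (List ℕ) → Bool
  rowSumsᵇ A = allB (λ r → sum r ≡ᵇ t) A

  columnSumsᵇ : ℕ → List ℕ → List (List ℕ) → Bool
  columnSumsᵇ n c A = allB (λ j → sum (column j A) ≡ᵇ entry j c) (upTo n)

  isMagicᵇ : ℕ → List ℕ → List (List ℕ) → Bool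
  isMagicᵇ n c A = rowSumsᵇ A ∧ columnSumsᵇ n c A

  fitsUnderᵇ : ℕ → List ℕ → List ℕ → Bool
  fitsUnderᵇ n c r = allB (λ j → entry j r ≤ᵇ entry j c) (upTo n)

  countArrays : List ℕ → ℕ → List ℕ → ℕ
  countArrays ks n c = ΣL (arraysOfShape ks entryValues) (λ A → bit (isMagicᵇ n c A))

  eP≡countArrays : ∀ m → eP (suc (suc m)) t ≡ countArrays (rowLengths (suc (suc m))) (suc (suc m)) (replicate (suc (suc m)) t)
  eP≡countArrays m =
    trans (length-sum (filter (isMagic? n t) L))
     (trans (ΣL-filter (isMagic? n t) L (λ _ → 1))
       (ΣL-cong L (λ A → trans (ℕP.*-identityʳ _) (cong bit (decisions-agree A)))))
    where
    n = suc (suc m)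
    L = arraysOfShape (rowLengths n) entryValues
    decisions-agree : ∀ A → does (isMagic? n t A) ≡ isMagicᵇ n (replicate n t) A
    decisions-agree A = cong₂ _∧_ (does-all? (λ r → sum r ℕP.≟ t) A)
             (trans (does-all? (λ j → sum (column j A) ℕP.≟ t) (upTo n))
               (allB-upTo-cong _ _ n (λ j lt → cong (sum (column j A) ≡ᵇ_) (sym (entry-replicate j n t lt)))))

  isMagicᵇ-∷ : ∀ n c r A → isMagicᵇ n c (r ∷ A) ≡ ((sum r ≡ᵇ t) ∧ fitsUnderᵇ n c r) ∧ isMagicᵇ n (c ⊖ r) A
  isMagicᵇ-∷ n c r A =
    trans (cong (((sum r ≡ᵇ t) ∧ rowSumsᵇ A) ∧_)
            (trans (allB-cong (upTo n) (λ j → trans (cong (_≡ᵇ entry j c) (sum-column-∷ j r A))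
                       (trans (+≡ᵇ-split (entry j r) (sum (column j A)) (entry j c))
                         (cong (λ u → (entry j r ≤ᵇ entry j c) ∧ (sum (column j A) ≡ᵇ u)) (sym (entry-⊖ j c r))))))
                   (allB-∧ (λ j → entry j r ≤ᵇ entry j c) (λ j → sum (column j A) ≡ᵇ entry j (c ⊖ r)) (upTo n))))
          (∧-rearr (sum r ≡ᵇ t) (rowSumsᵇ A) (fitsUnderᵇ n c r) (columnSumsᵇ n (c ⊖ r) A))
    where
    allB-cong : ∀ xs {p q : ℕ → Bool} → (∀ j → p j ≡ q j) → allB p xs ≡ allB q xs
    allB-cong [] e = refl
    allB-cong (x ∷ xs) e = cong₂ _∧_ (e x) (allB-cong xs e)

  countArrays-∷ : ∀ k ks n c → countArrays (k ∷ ks) n c ≡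
    ΣL (listsOver k entryValues) (λ r → bit ((sum r ≡ᵇ t) ∧ fitsUnderᵇ n c r) * countArrays ks n (c ⊖ r))
  countArrays-∷ k ks n c =
    trans (ΣL-concatMap (λ r → map (r ∷_) (arraysOfShape ks entryValues)) (listsOver k entryValues) (λ A → bit (isMagicᵇ n c A)))
     (ΣL-cong (listsOver k entryValues) (λ r → trans (ΣL-map (r ∷_) (arraysOfShape ks entryValues) (λ A → bit (isMagicᵇ n c A)))
        (trans (ΣL-cong (arraysOfShape ks entryValues) (λ A → trans (cong bit (isMagicᵇ-∷ n c r A))
                   (bit-∧ ((sum r ≡ᵇ t) ∧ fitsUnderᵇ n c r) (isMagicᵇ n (c ⊖ r) A))))
               (ΣL-*l (arraysOfShape ks entryValues) (bit ((sum r ≡ᵇ t) ∧ fitsUnderᵇ n c r)) (λ A → bit (isMagicᵇ n (c ⊖ r) A))))))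

  ΣL-listsOver-cong-bounded : ∀ L f g → (∀ r → length r ≡ L → All (λ x → x ≤ t) r → f r ≡ g r) →
    ΣL (listsOver L entryValues) f ≡ ΣL (listsOver L entryValues) g
  ΣL-listsOver-cong-bounded zero f g h = cong (_+ 0) (h [] refl [])
  ΣL-listsOver-cong-bounded (suc L) f g h =
    trans (ΣL-listsOver L entryValues f)
     (trans (ΣL-upTo (suc t) (λ x → ΣL (listsOver L entryValues) (λ r → f (x ∷ r))))
      (trans (sumℕ-cong (suc t) (λ x lt → ΣL-listsOver-cong-bounded L (λ r → f (x ∷ r)) (λ r → g (x ∷ r))
                 (λ r lr ar → h (x ∷ r) (cong suc lr) (ℕP.≤-pred lt ∷ ar))))
       (sym (trans (ΣL-listsOver L entryValues g) (ΣL-upTo (suc t) (λ x → ΣL (listsOver L entryValues) (λ r → g (x ∷ r))))))))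

  fitsDeficitsᵇ : List ℕ → List ℕ → Bool
  fitsDeficitsᵇ [] r = true
  fitsDeficitsᵇ (d ∷ ds) [] = false
  fitsDeficitsᵇ (d ∷ ds) (x ∷ r) = (x ≤ᵇ d) ∧ fitsDeficitsᵇ ds r

  newDeficits : List ℕ → List ℕ → List ℕ
  newDeficits [] [] = []
  newDeficits [] (y ∷ r) = t ∸ y ∷ []
  newDeficits (d ∷ ds) [] = []
  newDeficits (d ∷ ds) (x ∷ r) = d ∸ x ∷ newDeficits ds r

  step-asListsOver : ∀ ds s g → step ds s g ≡
    ΣL (listsOver (suc (length ds)) entryValues) (λ r → bit (fitsDeficitsᵇ ds r) * bit (s + sum r ≡ᵇ t) * g (newDeficits ds r))
  step-asListsOver [] s g =
    sym (trans (ΣL-listsOver 0 entryValues F) (trans (ΣL-upTo (suc t) (λ y → F (y ∷ []) + 0))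
      (sumℕ-cong (suc t) (λ y _ → trans (ℕP.+-identityʳ _)
          (trans (cong (_* g (t ∸ y ∷ [])) (ℕP.*-identityˡ (bit (s + (y + 0) ≡ᵇ t))))
            (cong (λ u → bit (s + u ≡ᵇ t) * g (t ∸ y ∷ [])) (ℕP.+-identityʳ y)))))))
    where
    F : List ℕ → ℕ
    F r = bit (fitsDeficitsᵇ [] r) * bit (s + sum r ≡ᵇ t) * g (newDeficits [] r)
  step-asListsOver (d ∷ ds) s g =
    trans (sumℕ-cong (suc t) (λ x _ → trans (cong (bit (x ≤ᵇ d) *_) (step-asListsOver ds (s + x) (λ zs → g (d ∸ x ∷ zs))))
              (trans (sym (ΣL-*l (listsOver (suc (length ds)) entryValues) (bit (x ≤ᵇ d)) _))
                (ΣL-cong (listsOver (suc (length ds)) entryValues) (λ r → pointwise x r)))))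
     (sym (trans (ΣL-listsOver (suc (length ds)) entryValues F) (ΣL-upTo (suc t) (λ x → ΣL (listsOver (suc (length ds)) entryValues) (λ r → F (x ∷ r))))))
    where
    F : List ℕ → ℕ
    F r = bit (fitsDeficitsᵇ (d ∷ ds) r) * bit (s + sum r ≡ᵇ t) * g (newDeficits (d ∷ ds) r)
    pointwise : ∀ x r → bit (x ≤ᵇ d) * (bit (fitsDeficitsᵇ ds r) * bit (s + x + sum r ≡ᵇ t) * g (d ∸ x ∷ newDeficits ds r)) ≡ F (x ∷ r)
    pointwise x r rewrite bit-∧ (x ≤ᵇ d) (fitsDeficitsᵇ ds r) | ℕP.+-assoc s x (sum r) =
      sym (trans (ℕP.*-assoc (bit (x ≤ᵇ d) * bit (fitsDeficitsᵇ ds r)) _ _)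
            (trans (ℕP.*-assoc (bit (x ≤ᵇ d)) _ _)
              (cong (bit (x ≤ᵇ d) *_) (sym (ℕP.*-assoc (bit (fitsDeficitsᵇ ds r)) _ _)))))

  fitsDeficitsᵇ-sound : ∀ ds r → T (fitsDeficitsᵇ ds r) → ∀ j → j < length ds → entry j r ≤ entry j ds
  fitsDeficitsᵇ-sound (d ∷ ds) (x ∷ r) q zero _ =
    subst₂ _≤_ (sym (entry-0 x r)) (sym (entry-0 d ds)) (T-≤ᵇ (T∧₁ {x ≤ᵇ d} q))
  fitsDeficitsᵇ-sound (d ∷ ds) (x ∷ r) q (suc j) (s≤s lt) = fitsDeficitsᵇ-sound ds r (T∧₂ {x ≤ᵇ d} q) j lt

  fitsDeficitsᵇ-complete : ∀ ds r → length r ≡ suc (length ds) → (∀ j → j < length ds → entry j r ≤ entry j ds) → T (fitsDeficitsᵇ ds r)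
  fitsDeficitsᵇ-complete [] r _ _ = tt
  fitsDeficitsᵇ-complete (d ∷ ds) (x ∷ r) el h =
    T∧ (≤ᵇ-T (subst₂ _≤_ (entry-0 x r) (entry-0 d ds) (h 0 (s≤s z≤n))))
       (fitsDeficitsᵇ-complete ds r (ℕP.suc-injective el) (λ j lt → h (suc j) (s≤s lt)))

  fitsUnderᵇ≡fitsDeficitsᵇ : ∀ ds k r → length r ≡ suc (length ds) → All (λ x → x ≤ t) r →
    fitsUnderᵇ (length ds + suc k) (ds ++ replicate (suc k) t) r ≡ fitsDeficitsᵇ ds r
  fitsUnderᵇ≡fitsDeficitsᵇ ds k r el ar = T-ext _ _
    (λ q → fitsDeficitsᵇ-complete ds r el (λ j lt →
       subst (entry j r ≤_) (entry-++ˡ j ds _ lt)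
         (T-≤ᵇ (T-allB-upTo _ (length ds + suc k) q j (ℕP.<-≤-trans lt (ℕP.m≤m+n (length ds) (suc k)))))))
    (λ q → allB-upTo-T _ (length ds + suc k) (λ j lt → ≤ᵇ-T (bound j lt q)))
    where
    bound : ∀ j → j < length ds + suc k → T (fitsDeficitsᵇ ds r) → entry j r ≤ entry j (ds ++ replicate (suc k) t)
    bound j lt q with ℕP.<-cmp j (length ds)
    ... | tri< jl _ _ = subst (entry j r ≤_) (sym (entry-++ˡ j ds _ jl)) (fitsDeficitsᵇ-sound ds r q j jl)
    ... | tri≈ _ e _ = at-boundary e
      where
      at-boundary : j ≡ length ds → entry j r ≤ entry j (ds ++ replicate (suc k) t)
      at-boundary e = subst (entry j r ≤_) (sym (trans (cong (λ u → entry u (ds ++ replicate (suc k) t)) (trans e (sym (ℕP.+-identityʳ _))))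
                   (trans (entry-++ʳ 0 ds (replicate (suc k) t)) (entry-replicate 0 (suc k) t (s≤s z≤n))))) (entry-≤ j r t ar)
    ... | tri> _ _ gt = subst (entry j r ≤_) (sym eqt) (entry-≤ j r t ar)
      where
      j' = j ∸ length ds
      ej : length ds + j' ≡ j
      ej = ℕP.m+[n∸m]≡n (ℕP.<⇒≤ gt)
      j'lt : j' < suc k
      j'lt = ℕP.+-cancelˡ-< (length ds) j' (suc k) (subst (_< length ds + suc k) (sym ej) lt)
      eqt : entry j (ds ++ replicate (suc k) t) ≡ t
      eqt = trans (cong (λ u → entry u (ds ++ replicate (suc k) t)) (sym ej))
              (trans (entry-++ʳ j' ds (replicate (suc k) t)) (entry-replicate j' (suc k) t j'lt))

  ⊖-padded : ∀ ds k r → length r ≡ suc (length ds) → (ds ++ replicate (suc k) t) ⊖ r ≡ newDeficits ds r ++ replicate k t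
  ⊖-padded [] k (y ∷ []) _ = cong (t ∸ y ∷_) (⊖[] (replicate k t))
  ⊖-padded (d ∷ ds) k (x ∷ r) el = cong (d ∸ x ∷_) (⊖-padded ds k r (ℕP.suc-injective el))

  length-newDeficits : ∀ ds r → length r ≡ suc (length ds) → length (newDeficits ds r) ≡ suc (length ds)
  length-newDeficits [] (y ∷ []) _ = refl
  length-newDeficits (d ∷ ds) (x ∷ r) el = cong suc (length-newDeficits ds r (ℕP.suc-injective el))

  sum-newDeficits : ∀ ds r → T (fitsDeficitsᵇ ds r) → length r ≡ suc (length ds) → All (λ x → x ≤ t) r →
    sum (newDeficits ds r) + sum r ≡ sum ds + t
  sum-newDeficits [] (y ∷ []) _ _ (yt ∷ _) =
    trans (cong₂ _+_ (ℕP.+-identityʳ (t ∸ y)) (ℕP.+-identityʳ y)) (ℕP.m∸n+n≡m yt)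
  sum-newDeficits (d ∷ ds) (x ∷ r) q el (_ ∷ ar) =
    trans (rearrange (d ∸ x) (sum (newDeficits ds r)) x (sum r))
     (trans (cong₂ _+_ (ℕP.m∸n+n≡m (T-≤ᵇ {x} {d} (T∧₁ {x ≤ᵇ d} q)))
                       (sum-newDeficits ds r (T∧₂ {x ≤ᵇ d} q) (ℕP.suc-injective el) ar))
            (sym (ℕP.+-assoc d (sum ds) t)))
    where
    rearrange : ∀ a S x R → (a + S) + (x + R) ≡ (a + x) + (S + R)
    rearrange = solve-∀

  entries-countOnce : ∀ ds → sum ds ≡ t → All (λ x → ΣL entryValues (λ y → bit (x ≡ᵇ y)) ≡ 1) ds
  entries-countOnce ds e = All.map (λ {x} le → trans (ΣL-upTo (suc t) (λ y → bit (x ≡ᵇ y)))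
                      (trans (count-upTo (suc t) x) (bit≡1 _ (ℕP.<⇒<ᵇ (s≤s (subst (x ≤_) e le))))))
                   (All-≤-sum ds)

  lastRow-forced : ∀ ds → sum ds ≡ t → ∀ r → length r ≡ length ds →
    bit ((sum r ≡ᵇ t) ∧ fitsUnderᵇ (length ds) ds r) * countArrays [] (length ds) (ds ⊖ r) ≡ bit (sameList ds r)
  lastRow-forced ds e r el =
    trans (bit-∧0 (rowTest r) (columnSumsᵇ L (ds ⊖ r) [])) (cong bit (T-ext _ _ accepted⇒same same⇒accepted))
    where
    L = length ds
    rowTest : List ℕ → Bool
    rowTest u = (sum u ≡ᵇ t) ∧ fitsUnderᵇ L ds u
    accepted⇒same : T (rowTest r ∧ columnSumsᵇ L (ds ⊖ r) []) → T (sameList ds r)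
    accepted⇒same q = subst (λ u → T (sameList ds u)) (sym r≡ds) (subst T (sym (sameList-refl ds)) tt)
      where
      fits = T∧₂ {sum r ≡ᵇ t} (T∧₁ {rowTest r} q)
      exhausts = T∧₂ {rowTest r} q
      r≡ds : r ≡ ds
      r≡ds = entry-ext r ds el (λ j lt → ℕP.≤-antisym
               (T-≤ᵇ (T-allB-upTo _ L fits j (subst (j <_) el lt)))
               (ℕP.m∸n≡0⇒m≤n (sym (trans (T-≡ᵇ (T-allB-upTo _ L exhausts j (subst (j <_) el lt))) (entry-⊖ j ds r)))))
    same⇒accepted : T (sameList ds r) → T (rowTest r ∧ columnSumsᵇ L (ds ⊖ r) [])
    same⇒accepted q = subst (λ u → T (rowTest u ∧ columnSumsᵇ L (ds ⊖ u) [])) (sameList-sound ds r q)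
      (T∧ (T∧ (≡ᵇ-T e) (allB-upTo-T _ L (λ j _ → ≤ᵇ-T (ℕP.≤-refl {entry j ds}))))
          (allB-upTo-T _ L (λ j _ → ≡ᵇ-T (sym (trans (entry-⊖ j ds ds) (ℕP.n∸n≡0 (entry j ds)))))))

  countArrays-lastRow : ∀ ds → sum ds ≡ t → countArrays (length ds ∷ []) (length ds) ds ≡ 1
  countArrays-lastRow ds e =
    trans (countArrays-∷ (length ds) [] (length ds) ds)
     (trans (ΣL-listsOver-cong-bounded (length ds) _ (λ r → bit (sameList ds r)) (λ r el _ → lastRow-forced ds e r el))
       (trans (count-listsOver entryValues (length ds) ds (entries-countOnce ds e)) (bit≡1 _ (≡ᵇ-T {length ds} {length ds} refl))))

  countArrays≡completions : ∀ k ds → sum ds ≡ t → countArrays (rowLengthsFrom (length ds) k) (length ds + k) (ds ++ replicate k t) ≡ completions ds k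
  countArrays≡completions zero ds e =
    trans (cong₂ (λ n c → countArrays (length ds ∷ []) n c) (ℕP.+-identityʳ (length ds)) (++-identityʳ ds)) (countArrays-lastRow ds e)
  countArrays≡completions (suc k) ds e =
    trans (countArrays-∷ (suc L) (rowLengthsFrom (suc L) k) n c)
     (trans (ΣL-listsOver-cong-bounded (suc L) _ _ pointwise) (sym (step-asListsOver ds 0 (λ zs → completions zs k))))
    where
    L = length ds
    n = L + suc k
    c = ds ++ replicate (suc k) t
    pointwise : ∀ r → length r ≡ suc L → All (λ x → x ≤ t) r →
      bit ((sum r ≡ᵇ t) ∧ fitsUnderᵇ n c r) * countArrays (rowLengthsFrom (suc L) k) n (c ⊖ r) ≡
      bit (fitsDeficitsᵇ ds r) * bit (0 + sum r ≡ᵇ t) * completions (newDeficits ds r) k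
    pointwise r el ar =
      trans (cong₂ (λ b u → bit ((sum r ≡ᵇ t) ∧ b) * u) (fitsUnderᵇ≡fitsDeficitsᵇ ds k r el ar) (cong (countArrays (rowLengthsFrom (suc L) k) n) (⊖-padded ds k r el)))
       (trans (bit-*-cong ((sum r ≡ᵇ t) ∧ fitsDeficitsᵇ ds r) _ _ continue)
        (trans (cong (_* completions ns k) (bit-∧ (sum r ≡ᵇ t) (fitsDeficitsᵇ ds r)))
          (cong (_* completions ns k) (ℕP.*-comm (bit (sum r ≡ᵇ t)) (bit (fitsDeficitsᵇ ds r))))))
      where
      ns = newDeficits ds r
      length-ns : length ns ≡ suc L
      length-ns = length-newDeficits ds r el
      continue : T ((sum r ≡ᵇ t) ∧ fitsDeficitsᵇ ds r) → countArrays (rowLengthsFrom (suc L) k) n (ns ++ replicate k t) ≡ completions ns k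
      continue q = trans (cong₂ (λ a b → countArrays (rowLengthsFrom a k) b (ns ++ replicate k t)) (sym length-ns)
                      (trans (ℕP.+-suc L k) (cong (_+ k) (sym length-ns))))
                    (countArrays≡completions k ns ns-sum)
        where
        row-sum : sum r ≡ t
        row-sum = T-≡ᵇ (T∧₁ {sum r ≡ᵇ t} q)
        ns-sum : sum ns ≡ t
        ns-sum = ℕP.+-cancelʳ-≡ t (sum ns) t
          (trans (cong (sum ns +_) (sym row-sum))
            (trans (sum-newDeficits ds r (T∧₂ {sum r ≡ᵇ t} q) el ar) (cong (_+ t) e)))

  eP≡completions : ∀ m → eP (suc (suc m)) t ≡ completions (t ∷ []) (suc m)
  eP≡completions m = trans (eP≡countArrays m)
    (trans (cong (λ ks → countArrays ks (suc (suc m)) (replicate (suc (suc m)) t)) (rowLengths≡rowLengthsFrom 0 (suc m)))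
           (countArrays≡completions (suc m) (t ∷ []) (ℕP.+-identityʳ t)))

module TransferSystem (t : ℕ) where

  open IntegerRangeSum
  open ListSum using (nth)
  open PartitionStates t
  open ArrayCount t using (eP≡completions)
  open CayleyHamilton using (Solves; linearSystem⇒recurrence)
  open import Defs using (eP)
  open import Data.Nat as ℕ using (ℕ; zero; suc; _<_)
  open import Data.Integer using (ℤ; +_; _*_)
  import Data.Integer.Properties as ℤP
  open import Data.Product using (proj₁; proj₂)
  open import Data.List using ([]; _∷_)
  open import Relation.Binary.PropositionalEquality

  state : ℕ → ℕ → ℤ
  state i k = + completions (nth partitions i) k

  state-solves : Solves p (λ i j → + transferMatrix i j) state
  state-solves i i<p k = trans (cong +_ (completions-suc i i<p k))
    (trans (+-sumℕ p (λ j → transferMatrix i j ℕ.* completions (nth partitions j) k))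
      (sumℤ-cong p (λ j _ → ℤP.pos-* (transferMatrix i j) (completions (nth partitions j) k))))

  i₀ : ℕ
  i₀ = proj₁ initialState

  i₀<p : i₀ < p
  i₀<p = proj₁ (proj₂ initialState)

  coefficients : ℕ → ℤ
  coefficients = proj₁ (linearSystem⇒recurrence p (λ i j → + transferMatrix i j) state state-solves)

  state-recurrence : ∀ k → state i₀ (k ℕ.+ p) ≡ sumℤ p (λ m → coefficients m * state i₀ (k ℕ.+ m))
  state-recurrence = proj₂ (linearSystem⇒recurrence p (λ i j → + transferMatrix i j) state state-solves) i₀ i₀<p

  eP≡state : ∀ n → + eP (suc n) t ≡ state i₀ n
  eP≡state zero = refl
  eP≡state (suc m) = cong +_ (trans (eP≡completions m)
    (trans (completions-normalise (suc m) (t ∷ [])) (cong (λ π → completions π (suc m)) (sym (proj₂ (proj₂ initialState))))))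

open import Defs
open import Data.Nat using (ℕ; _<_; _∸_; suc)
open import Data.Integer using (ℤ; +_; _*_)
open import Data.Fin using (Fin; toℕ)
open import Data.Product using (Σ; _,_)
open import Relation.Binary.PropositionalEquality using (_≡_)

theorem1 : (t : ℕ) →
    Σ (Fin (partitionCount t) → ℤ) λ c →
    (n : ℕ) → partitionCount t < n →
    + eP n t ≡ ∑ (λ i → c i * + eP (n ∸ suc (toℕ i)) t)
theorem1 t = (λ i → coefficients (p ∸ suc (toℕ i))) ,
  LinearRecurrence.recurrence⇒reversed-∑ p coefficients (λ n → + eP n t) (state i₀) eP≡state state-recurrence
  where
  open PartitionStates t using (p)
  open TransferSystem t
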